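{- Let $n\ge1$, let $\alpha=(\sigma,d,d')$ be a partial bijection of $n$, and let $X\in\mathbf{P}_n$ with $d\subseteq X$. The number of trivial extensions $\tilde\alpha=(\tilde\sigma,\tilde d,\tilde d')$ of $\alpha$ in $Q_n$ with $\tilde d=X$ is $$(2n-|d|)(2n-|d|-2)\cdots(2n-|d|-|X\setminus d|+2)=2^{\frac{|X\setminus d|}{2}}\Big(n-\frac{|d|}{2}\Big)_{\frac{|X\setminus d|}{2}}.$$ The same formula gives the number of trivial extensions $\tilde\alpha$ of $\alpha$ with $\tilde d'=X$ for $X\in\mathbf{P}_n$ with $d'\subseteq X$.
   Context: $(m)_k=m(m-1)\cdots(m-k+1)$. For $n\ge1$ let $\rho(k)=\{2k-1,2k\}$ and let $\mathbf{P}_n$ be the set of subsets of $[2n]$ that are unions of sets $\rho(k)$, $1\le k\le n$. A partial bijection of $n$ is a triple $\alpha=(\sigma,d,d')$ with $d,d'\in\mathbf{P}_n$ and $\sigma:d\to d'$ a bijection; $Q_n$ is the set of these. Coset-type $ct(\alpha)$: take a graph with vertex set $d$, vertex $x$ having exterior label $x$ and interior label $\sigma(x)$; join by an exterior edge the vertices with exterior labels $2i-1,2i$ and by an interior edge the vertices with interior labels $2i-1,2i$; the graph is a disjoint union of cycles of lengths $2\mu_1\ge2\mu_2\ge\cdots$ and $ct(\alpha)=(\mu_1,\mu_2,\dots)$. For partitions, $\lambda\cup\mu$ adds multiplicities of parts and $(1^j)$ has $j$ parts equal to $1$. $(\tilde\sigma,\tilde d,\tilde d')\in Q_n$ is a trivial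 extension of $(\sigma,d,d')$ if $d\subseteq\tilde d$, $\tilde\sigma|_d=\sigma$ and $ct(\tilde\sigma)=ct(\sigma)\cup(1^{|\tilde d\setminus d|/2})$. -}

module Defs where

open import Data.Nat using (ℕ; zero; suc; _+_; _*_; _∸_; _/_; _≡ᵇ_)
open import Data.Bool using (Bool; true; false; _∧_; _∨_; not; if_then_else_; T)
open import Data.Fin using (Fin; zero; suc; _≟_)
open import Data.Fin.Subset using (Subset; _⊆_; _─_; ∣_∣)
open import Data.Vec using (Vec; lookup)
open import Data.Maybe using (Maybe; just; nothing)
open import Data.Bool.ListAction using (all; any)
open import Data.List using (List; filter; length; cartesianProduct; allFin)
open import Data.List.Membership.Propositional using (_∈_)
open import Data.List.Relation.Unary.Unique.Propositional using (Unique)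
open import Data.Product using (_×_; _,_; Σ)


open import Relation.Nullary.Decidable using (⌊_⌋)
open import Relation.Binary.PropositionalEquality using (_≡_)
open import Function.Bundles using (_⇔_)

-- The ground set [2n].
-- A point (k , b) : Fin n × Fin 2 encodes the number 2k+1+b of [2n]
-- (k 0-based), so ρ(k+1) = {(k,0),(k,1)}.

Pt : ℕ → Set
Pt n = Fin n × Fin 2

flip2 : Fin 2 → Fin 2
flip2 zero = suc zero
flip2 (suc _) = zero

mate : ∀ {n} → Pt n → Pt n
mate (k , b) = (k , flip2 b)

_==ᵖ_ : ∀ {n} → Pt n → Pt n → Bool
(k , b) ==ᵖ (k' , b') = ⌊ k ≟ k' ⌋ ∧ ⌊ b ≟ b' ⌋

_==ᵐ_ : ∀ {n} → Maybe (Pt n) → Maybe (Pt n) → Bool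
just x ==ᵐ just y = x ==ᵖ y
nothing ==ᵐ nothing = true
_ ==ᵐ _ = false

allPts : ∀ n → List (Pt n)
allPts n = cartesianProduct (allFin n) (allFin 2)

forallP : ∀ {n} → (Pt n → Bool) → Bool
forallP {n} p = all p (allPts n)

existsP : ∀ {n} → (Pt n → Bool) → Bool
existsP {n} p = any p (allPts n)

countP : ∀ {n} → (Pt n → Bool) → ℕ
countP {n} p = length (filter (λ x → T? (p x)) (allPts n))
  where
  open import Relation.Nullary using (Dec; yes; no)
  T? : (b : Bool) → Dec (T b)
  T? true = yes _
  T? false = no (λ ())

-- P_n: a union of blocks ρ(k) is encoded by the set of its block
-- indices k, i.e. by a Subset n.  A point lies in it iff its block does.

Pn : ℕ → Set
Pn n = Subset n

inP : ∀ {n} → Pn n → Pt n → Bool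
inP d (k , _) = lookup d k

card : ∀ {n} → Pn n → ℕ
card d = 2 * ∣ d ∣

-- Raw triples (σ, d, d').  σ is stored as a partial map [2n] ⇀ [2n]
-- (a table of Maybe values, so that two maps with the same domain and
-- values are equal); IsPB says it is a bijection d → d'.

PMap : ℕ → Set
PMap n = Vec (Vec (Maybe (Pt n)) 2) n

app : ∀ {n} → PMap n → Pt n → Maybe (Pt n)
app f (k , b) = lookup (lookup f k) b

record Triple (n : ℕ) : Set where
  constructor triple
  field
    σ  : PMap n
    d  : Pn n
    d' : Pn n
open Triple public

isJustIn : ∀ {n} → Pn n → Maybe (Pt n) → Bool
isJustIn d' (just y) = inP d' y
isJustIn d' nothing = false

isPB : ∀ {n} → Triple n → Bool
isPB (triple f d d') =
  forallP (λ x → if inP d x then isJustIn d' (app f x) else (app f x ==ᵐ nothing))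
  ∧ forallP (λ x → forallP (λ x' →
        not (inP d x ∧ inP d x' ∧ (app f x ==ᵐ app f x')) ∨ (x ==ᵖ x')))
  ∧ forallP (λ y → not (inP d' y) ∨ existsP (λ x → inP d x ∧ (app f x ==ᵐ just y)))

IsPartialBijection : ∀ {n} → Triple n → Set
IsPartialBijection α = T (isPB α)

-- The graph of α has vertex set d; vertices x, y are joined
-- by an exterior edge iff {x,y} = ρ(i) for some i, i.e. y = mate x, and
-- by an interior edge iff {σ x, σ y} = ρ(i), i.e. σ y = mate (σ x).
-- Every vertex lies on exactly one cycle; the cycle through x is its
-- connected component.

adj : ∀ {n} → Triple n → Pt n → Pt n → Bool
adj (triple f d d') x y =
  inP d x ∧ inP d y ∧ ((y ==ᵖ mate x) ∨ interior (app f x))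
  where
  interior : Maybe _ → Bool
  interior (just z) = app f y ==ᵐ just (mate z)
  interior nothing = false

reach : ∀ {n} → Triple n → ℕ → Pt n → Pt n → Bool
reach α zero x y = x ==ᵖ y
reach α (suc k) x y = reach α k x y ∨ existsP (λ z → reach α k x z ∧ adj α z y)

-- size (number of vertices) of the connected component (cycle) of x;
-- paths in a graph with ≤ 2n vertices have length < 2n
compSize : ∀ {n} → Triple n → Pt n → ℕ
compSize {n} α x = countP (reach α (2 * n) x)

-- Partitions are represented by their multiplicity functions
-- (m ↦ number of parts equal to m, for m ≥ 1).
Partition : Set
Partition = ℕ → ℕ

-- ct(α): the multiplicity of the part m is the number of cycles of
-- length 2m, i.e. (number of vertices on cycles of length 2m) / 2m.
ct : ∀ {n} → Triple n → Partition
ct α zero = 0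
ct α (suc m) =
  countP (λ x → inP (d α) x ∧ (compSize α x ≡ᵇ 2 * suc m)) / (2 * suc m)

_∪ₚ_ : Partition → Partition → Partition
(λ₁ ∪ₚ μ) m = λ₁ m + μ m

ones : ℕ → Partition
ones j zero = 0
ones j (suc zero) = j
ones j (suc (suc _)) = 0

_≈ₚ_ : Partition → Partition → Set
λ₁ ≈ₚ μ = ∀ m → λ₁ (suc m) ≡ μ (suc m)

record IsTrivialExtension {n} (α̃ α : Triple n) : Set where
  field
    partialBij : IsPartialBijection α̃
    domSub     : d α ⊆ d α̃
    restrict   : ∀ x → T (inP (d α) x) → app (σ α̃) x ≡ app (σ α) x
    cosetType  : ct α̃ ≈ₚ (ct α ∪ₚ ones (card (d α̃ ─ d α) / 2))

HasCount : ∀ {n} → (Triple n → Set) → ℕ → Set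
HasCount {n} P N =
  Σ (List (Triple n)) λ L → Unique L × (∀ β → (β ∈ L) ⇔ P β) × length L ≡ N

module Submission where

-- Since σ̃ extends the bijection σ, the vertices of d span the same cycles in the graph of α̃ as
-- in that of α, so ct(α̃) = ct(α) ∪ (1^k) exactly when every vertex x of d̃ ∖ d lies on a 2-cycle.
-- That cycle can only be {x, mate x}, and it is closed under interior edges iff σ̃ maps the block
-- of x onto a block; otherwise the cycle through x has a third vertex. So the trivial extensions
-- with d̃ = X arise by sending the k = |X ∖ d|/2 new blocks, one after the other, onto distinct
-- blocks outside d', each in one of 2 orientations: the j-th new block has 2 (n − |d'|/2 − j)
-- choices, and |d'| = |d|. Extensions with prescribed codomain are the inverses of the
-- extensions of α⁻¹ with prescribed domain.

open import Defs
open import Data.Nat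
open import Data.Nat.Properties
open import Data.Nat.Tactic.RingSolver using (solve-∀)
open import Data.Nat.DivMod using (+-distrib-/-∣ʳ; m*n/n≡m)
open import Data.Nat.Divisibility.Core using (divides)
open import Data.Nat.Combinatorics using (_P_)
open import Data.Nat.Combinatorics.Base using (_P′_)
open import Data.Bool using (Bool; true; false; T; if_then_else_; _∧_; _∨_; not)
open import Data.Bool.Properties using (∧-identityʳ; ∧-zeroʳ; ¬-not; not-involutive; ⇔→≡; T-≡)
open import Data.Bool.ListAction using (all; any)
open import Data.Fin using (Fin; zero; suc)
import Data.Fin as F
import Data.Fin.Properties as FP
open import Data.Fin.Subset using (Subset; _⊆_; _─_; ∁; ∣_∣)
open import Data.Fin.Subset.Properties using (∣∁p∣≡n∸∣p∣)
open import Data.Vec as V using (Vec; []; _∷_; lookup; _[_]≔_)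
open import Data.Vec.Properties
  using ( []=⇒lookup; lookup⇒[]=; lookup-map; ∷-injectiveʳ; tabulate∘lookup; tabulate-cong
        ; lookup∘tabulate; lookup∘update; lookup∘update′)
open import Data.Maybe as M using (Maybe; just; nothing; fromMaybe)
open import Data.Maybe.Properties using (just-injective)
open import Data.List as L using (List; []; _∷_; _++_; filter; length; allFin)
open import Data.List.Properties using (filter-≐; length-map; length-++)
open import Data.List.Membership.Propositional using (_∈_; find; lose)
open import Data.List.Membership.Propositional.Properties
open import Data.List.Relation.Unary.Any using (here; there)
open import Data.List.Relation.Unary.All as All using (All; []; _∷_)
import Data.List.Relation.Unary.All.Properties as AllP
open import Data.List.Relation.Unary.AllPairs as AllPairs using ([]; _∷_)
import Data.List.Relation.Unary.AllPairs.Properties as AllPairsP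
open import Data.List.Relation.Unary.Unique.Propositional using (Unique)
import Data.List.Relation.Unary.Unique.Propositional.Properties as Unique
open import Data.List.Relation.Binary.Disjoint.Propositional using (Disjoint)
open import Data.Product
open import Data.Sum as Sum using (_⊎_; inj₁; inj₂; [_,_]′)
open import Data.Empty using (⊥; ⊥-elim)
open import Function using (id; _∘_)
open import Function.Bundles using (mk⇔; Equivalence)
open import Relation.Nullary using (¬_; yes; no; contradiction)
open import Relation.Nullary.Decidable using (T?)
open import Relation.Binary.PropositionalEquality

∧-elimˡ : ∀ {a b} → a ∧ b ≡ true → a ≡ true
∧-elimˡ {true} _ = refl

∧-elimʳ : ∀ {a b} → a ∧ b ≡ true → b ≡ true
∧-elimʳ {true} e = e

∧-intro : ∀ {a b} → a ≡ true → b ≡ true → a ∧ b ≡ true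
∧-intro refl refl = refl

∨-elim : ∀ {a b} → a ∨ b ≡ true → a ≡ true ⊎ b ≡ true
∨-elim {true} _ = inj₁ refl
∨-elim {false} e = inj₂ e

∨-introˡ : ∀ {a b} → a ≡ true → a ∨ b ≡ true
∨-introˡ refl = refl

∨-introʳ : ∀ {a b} → b ≡ true → a ∨ b ≡ true
∨-introʳ {true} _ = refl
∨-introʳ {false} e = e

true≢false : true ≢ false
true≢false ()

≡true-ext : ∀ {a b} → (a ≡ true → b ≡ true) → (b ≡ true → a ≡ true) → a ≡ b
≡true-ext to from = ⇔→≡ (mk⇔ to from)

flip2-involutive : ∀ b → flip2 (flip2 b) ≡ b
flip2-involutive zero = refl
flip2-involutive (suc zero) = refl

flip2-≢ : ∀ b → flip2 b ≢ b
flip2-≢ zero ()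
flip2-≢ (suc zero) ()

mate-involutive : ∀ {n} (x : Pt n) → mate (mate x) ≡ x
mate-involutive (k , b) = cong (k ,_) (flip2-involutive b)

mate-≢ : ∀ {n} (x : Pt n) → mate x ≢ x
mate-≢ (k , b) e = flip2-≢ b (cong proj₂ e)

inP-mate : ∀ {n} (S : Pn n) x → inP S (mate x) ≡ inP S x
inP-mate S (k , b) = refl

==ᵖ⇒≡ : ∀ {n} (x y : Pt n) → (x ==ᵖ y) ≡ true → x ≡ y
==ᵖ⇒≡ (k , b) (k' , b') e with k F.≟ k' | b F.≟ b'
... | yes refl | yes refl = refl
... | yes _ | no _ = contradiction e λ ()
... | no _ | _ = contradiction e λ ()

==ᵖ-refl : ∀ {n} (x : Pt n) → (x ==ᵖ x) ≡ true
==ᵖ-refl (k , b) with k F.≟ k | b F.≟ b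
... | yes _ | yes _ = refl
... | yes _ | no b≢b = contradiction refl b≢b
... | no k≢k | _ = contradiction refl k≢k

==ᵐ⇒≡ : ∀ {n} (a b : Maybe (Pt n)) → (a ==ᵐ b) ≡ true → a ≡ b
==ᵐ⇒≡ (just x) (just y) e = cong just (==ᵖ⇒≡ x y e)
==ᵐ⇒≡ nothing nothing _ = refl

≡⇒==ᵐ : ∀ {n} {a b : Maybe (Pt n)} → a ≡ b → (a ==ᵐ b) ≡ true
≡⇒==ᵐ {a = just x} refl = ==ᵖ-refl x
≡⇒==ᵐ {a = nothing} refl = refl

nothing≢just : ∀ {A : Set} {a : A} → nothing ≢ just a
nothing≢just ()

allPts-complete : ∀ {n} (x : Pt n) → x ∈ allPts n
allPts-complete (k , b) = ∈-cartesianProduct⁺ (∈-allFin k) (∈-allFin b)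

allPts-unique : ∀ n → Unique (allPts n)
allPts-unique n = Unique.cartesianProduct⁺ (Unique.allFin⁺ n) (Unique.allFin⁺ 2)

all-elim : ∀ {A : Set} (p : A → Bool) xs → all p xs ≡ true → ∀ {x} → x ∈ xs → p x ≡ true
all-elim p (y ∷ xs) e (here refl) = ∧-elimˡ e
all-elim p (y ∷ xs) e (there m) = all-elim p xs (∧-elimʳ {p y} e) m

all-intro : ∀ {A : Set} (p : A → Bool) xs → (∀ x → x ∈ xs → p x ≡ true) → all p xs ≡ true
all-intro p [] h = refl
all-intro p (y ∷ xs) h = ∧-intro (h y (here refl)) (all-intro p xs (λ x m → h x (there m)))

any-intro : ∀ {A : Set} (p : A → Bool) xs {x} → x ∈ xs → p x ≡ true → any p xs ≡ true
any-intro p (y ∷ xs) (here refl) e = ∨-introˡ e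
any-intro p (y ∷ xs) (there m) e = ∨-introʳ {p y} (any-intro p xs m e)

any-elim : ∀ {A : Set} (p : A → Bool) xs → any p xs ≡ true → ∃ λ x → p x ≡ true
any-elim p (y ∷ xs) e with ∨-elim {p y} e
... | inj₁ e' = y , e'
... | inj₂ e' = any-elim p xs e'

any-cong : ∀ {A : Set} (p q : A → Bool) xs → (∀ x → p x ≡ q x) → any p xs ≡ any q xs
any-cong p q [] h = refl
any-cong p q (y ∷ xs) h = cong₂ _∨_ (h y) (any-cong p q xs h)

forallP-elim : ∀ {n} (p : Pt n → Bool) → forallP p ≡ true → ∀ x → p x ≡ true
forallP-elim {n} p e x = all-elim p (allPts n) e (allPts-complete x)

forallP-intro : ∀ {n} (p : Pt n → Bool) → (∀ x → p x ≡ true) → forallP p ≡ true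
forallP-intro {n} p h = all-intro p (allPts n) (λ x _ → h x)

existsP-intro : ∀ {n} (p : Pt n → Bool) x → p x ≡ true → existsP p ≡ true
existsP-intro {n} p x e = any-intro p (allPts n) (allPts-complete x) e

existsP-elim : ∀ {n} (p : Pt n → Bool) → existsP p ≡ true → ∃ λ x → p x ≡ true
existsP-elim {n} p = any-elim p (allPts n)

existsP-cong : ∀ {n} (p q : Pt n → Bool) → (∀ x → p x ≡ q x) → existsP p ≡ existsP q
existsP-cong {n} p q = any-cong p q (allPts n)

count : ∀ {A : Set} → (A → Bool) → List A → ℕ
count p [] = 0
count p (x ∷ xs) = if p x then suc (count p xs) else count p xs

filterᵇ : ∀ {A : Set} → (A → Bool) → List A → List A
filterᵇ p = filter (T? ∘ p)

length-filterᵇ : ∀ {A : Set} (p : A → Bool) xs → length (filterᵇ p xs) ≡ count p xs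
length-filterᵇ p [] = refl
length-filterᵇ p (x ∷ xs) with p x
... | true = cong suc (length-filterᵇ p xs)
... | false = length-filterᵇ p xs

∈-filterᵇ⁺ : ∀ {A : Set} (p : A → Bool) {xs x} → x ∈ xs → p x ≡ true → x ∈ filterᵇ p xs
∈-filterᵇ⁺ p m e = ∈-filter⁺ (T? ∘ p) m (Equivalence.from T-≡ e)

∈-filterᵇ⁻ : ∀ {A : Set} (p : A → Bool) xs {x} → x ∈ filterᵇ p xs → p x ≡ true
∈-filterᵇ⁻ p xs m = Equivalence.to T-≡ (proj₂ (∈-filter⁻ (T? ∘ p) {xs = xs} m))

filterᵇ-unique : ∀ {A : Set} (p : A → Bool) {xs} → Unique xs → Unique (filterᵇ p xs)
filterᵇ-unique p = Unique.filter⁺ (T? ∘ p)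

countP≡count : ∀ {n} (p : Pt n → Bool) → countP p ≡ count p (allPts n)
countP≡count {n} p =
  trans (cong length (filter-≐ _ (T? ∘ p) (id , id) (allPts n))) (length-filterᵇ p (allPts n))

count-cong : ∀ {A : Set} (p q : A → Bool) xs → (∀ x → p x ≡ q x) → count p xs ≡ count q xs
count-cong p q [] h = refl
count-cong p q (x ∷ xs) h rewrite h x with q x
... | true = cong suc (count-cong p q xs h)
... | false = count-cong p q xs h

countP-cong : ∀ {n} (p q : Pt n → Bool) → (∀ x → p x ≡ q x) → countP p ≡ countP q
countP-cong {n} p q h =
  trans (countP≡count p) (trans (count-cong p q (allPts n) h) (sym (countP≡count q)))

count-split : ∀ {A : Set} (p q : A → Bool) xs →
  count p xs ≡ count (λ x → p x ∧ q x) xs + count (λ x → p x ∧ not (q x)) xs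
count-split p q [] = refl
count-split p q (x ∷ xs) with p x | q x
... | true | true = cong suc (count-split p q xs)
... | true | false = trans (cong suc (count-split p q xs)) (sym (+-suc _ _))
... | false | _ = count-split p q xs

count-∧-≤ : ∀ {A : Set} (p q : A → Bool) xs → count (λ x → p x ∧ q x) xs ≤ count p xs
count-∧-≤ p q [] = z≤n
count-∧-≤ p q (x ∷ xs) with p x | q x
... | true | true = s≤s (count-∧-≤ p q xs)
... | true | false = m≤n⇒m≤1+n (count-∧-≤ p q xs)
... | false | _ = count-∧-≤ p q xs

count-∧-≡⇒ : ∀ {A : Set} (p q : A → Bool) xs → count (λ x → p x ∧ q x) xs ≡ count p xs →
  ∀ {x} → x ∈ xs → p x ≡ true → q x ≡ true
count-∧-≡⇒ p q (y ∷ xs) e (here refl) px with p y | q y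
... | true | true = refl
... | true | false = contradiction e (<⇒≢ (s≤s (count-∧-≤ p q xs)))
count-∧-≡⇒ p q (y ∷ xs) e (there m) px with p y | q y
... | true | true = count-∧-≡⇒ p q xs (suc-injective e) m px
... | true | false = contradiction e (<⇒≢ (s≤s (count-∧-≤ p q xs)))
... | false | _ = count-∧-≡⇒ p q xs e m px

count-false : ∀ {A : Set} (p : A → Bool) xs → (∀ x → p x ≡ false) → count p xs ≡ 0
count-false p [] h = refl
count-false p (x ∷ xs) h rewrite h x = count-false p xs h

unique-⊆⇒length≤ : ∀ {A : Set} (xs ys : List A) → Unique xs → (∀ {a} → a ∈ xs → a ∈ ys) →
  length xs ≤ length ys
unique-⊆⇒length≤ [] ys _ _ = z≤n
unique-⊆⇒length≤ (a ∷ xs) ys (a∉xs ∷ u) xs⊆ys with ∈-∃++ (xs⊆ys (here refl))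
... | ys₁ , ys₂ , refl = begin
  suc (length xs)            ≤⟨ s≤s (unique-⊆⇒length≤ xs (ys₁ ++ ys₂) u xs⊆ys₁ys₂) ⟩
  suc (length (ys₁ ++ ys₂))  ≡⟨ length-++-∷ ys₁ ⟩
  length (ys₁ ++ a ∷ ys₂)    ∎
  where
  open ≤-Reasoning
  length-++-∷ : ∀ zs → suc (length (zs ++ ys₂)) ≡ length (zs ++ a ∷ ys₂)
  length-++-∷ [] = refl
  length-++-∷ (z ∷ zs) = cong suc (length-++-∷ zs)
  ∈-delete : ∀ {x} zs → x ∈ zs ++ a ∷ ys₂ → x ≢ a → x ∈ zs ++ ys₂
  ∈-delete [] (here refl) x≢a = contradiction refl x≢a
  ∈-delete [] (there m) _ = m
  ∈-delete (z ∷ zs) (here refl) _ = here refl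
  ∈-delete (z ∷ zs) (there m) x≢a = there (∈-delete zs m x≢a)
  xs⊆ys₁ys₂ : ∀ {x} → x ∈ xs → x ∈ ys₁ ++ ys₂
  xs⊆ys₁ys₂ m = ∈-delete ys₁ (xs⊆ys (there m)) (λ x≡a → All.lookup a∉xs m (sym x≡a))

map-unique-on : ∀ {A B : Set} (f : A → B) xs → Unique xs →
  (∀ {x y} → x ∈ xs → y ∈ xs → f x ≡ f y → x ≡ y) → Unique (L.map f xs)
map-unique-on f [] _ _ = []
map-unique-on f (x ∷ xs) (x∉xs ∷ u) injOn =
  distinct xs x∉xs (λ m → injOn (here refl) (there m))
  ∷ map-unique-on f xs u (λ m m' → injOn (there m) (there m'))
  where
  distinct : ∀ ys → All (x ≢_) ys → (∀ {y} → y ∈ ys → f x ≡ f y → x ≡ y) → All (f x ≢_) (L.map f ys)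
  distinct [] _ _ = []
  distinct (y ∷ ys) (x≢y ∷ x∉ys) inj = (x≢y ∘ inj (here refl)) ∷ distinct ys x∉ys (inj ∘ there)

count-blocks : ∀ {n} (p : Pt n → Bool) → (∀ k → p (k , zero) ≡ p (k , suc zero)) →
  count p (allPts n) ≡ 2 * count (λ k → p (k , zero)) (allFin n)
count-blocks {n} p p-blockwise = go (allFin n)
  where
  go : ∀ ks → count p (L.cartesianProduct ks (allFin 2)) ≡ 2 * count (λ k → p (k , zero)) ks
  go [] = refl
  go (k ∷ ks) rewrite sym (p-blockwise k) with p (k , zero)
  ... | true = cong suc (trans (cong suc (go ks)) (sym (+-suc _ _)))
  ... | false = go ks

count-tabulate-lookup : ∀ {n} {A : Set} (S : Subset n) (f : Fin n → A) (p : A → Bool) →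
  (∀ i → p (f i) ≡ lookup S i) → count p (L.tabulate f) ≡ ∣ S ∣
count-tabulate-lookup [] f p h = refl
count-tabulate-lookup (b ∷ S) f p h rewrite h zero with b
... | true = cong suc (count-tabulate-lookup S (f ∘ suc) p (h ∘ suc))
... | false = count-tabulate-lookup S (f ∘ suc) p (h ∘ suc)

countP-inP : ∀ {n} (S : Pn n) → countP (inP S) ≡ card S
countP-inP {n} S = begin
  countP (inP S)                              ≡⟨ countP≡count (inP S) ⟩
  count (inP S) (allPts n)                    ≡⟨ count-blocks (inP S) (λ _ → refl) ⟩
  2 * count (lookup S) (allFin n)             ≡⟨ cong (2 *_) (count-tabulate-lookup S id (lookup S) (λ _ → refl)) ⟩
  card S                                      ∎
  where open ≡-Reasoning

≤-countP : ∀ {n} (p : Pt n → Bool) (xs : List (Pt n)) → Unique xs → All (λ x → p x ≡ true) xs →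
  length xs ≤ countP p
≤-countP {n} p xs u pxs = begin
  length xs                           ≤⟨ unique-⊆⇒length≤ xs _ u (λ m → ∈-filterᵇ⁺ p (allPts-complete _) (All.lookup pxs m)) ⟩
  length (filterᵇ p (allPts n))       ≡⟨ length-filterᵇ p (allPts n) ⟩
  count p (allPts n)                  ≡⟨ countP≡count p ⟨
  countP p                            ∎
  where open ≤-Reasoning

countP-≤ : ∀ {n} (p : Pt n → Bool) (xs : List (Pt n)) → (∀ {x} → p x ≡ true → x ∈ xs) →
  countP p ≤ length xs
countP-≤ {n} p xs h = begin
  countP p                            ≡⟨ countP≡count p ⟩
  count p (allPts n)                  ≡⟨ length-filterᵇ p (allPts n) ⟨
  length (filterᵇ p (allPts n))       ≤⟨ unique-⊆⇒length≤ _ xs (filterᵇ-unique p (allPts-unique n)) (h ∘ ∈-filterᵇ⁻ p (allPts n)) ⟩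
  length xs                           ∎
  where open ≤-Reasoning

record PartialBij {n} (α : Triple n) : Set where
  field
    defined    : ∀ x → inP (d α) x ≡ true → ∃ λ y → app (σ α) x ≡ just y × inP (d' α) y ≡ true
    undefined  : ∀ x → inP (d α) x ≡ false → app (σ α) x ≡ nothing
    injective  : ∀ x x' → inP (d α) x ≡ true → inP (d α) x' ≡ true → app (σ α) x ≡ app (σ α) x' → x ≡ x'
    surjective : ∀ y → inP (d' α) y ≡ true → ∃ λ x → inP (d α) x ≡ true × app (σ α) x ≡ just y

  defined⇒inDomain : ∀ x {y} → app (σ α) x ≡ just y → inP (d α) x ≡ true
  defined⇒inDomain x σx≡y with inP (d α) x in x∈d
  ... | true = refl
  ... | false = contradiction (trans (sym (undefined x x∈d)) σx≡y) nothing≢just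

module _ {n} (f : PMap n) (d d' : Pn n) where
  private
    α : Triple n
    α = triple f d d'
    totalOn : Pt n → Bool
    totalOn x = if inP d x then isJustIn d' (app f x) else (app f x ==ᵐ nothing)
    injectiveAt : Pt n → Pt n → Bool
    injectiveAt x x' = not (inP d x ∧ inP d x' ∧ (app f x ==ᵐ app f x')) ∨ (x ==ᵖ x')
    surjectiveAt : Pt n → Bool
    surjectiveAt y = not (inP d' y) ∨ existsP (λ x → inP d x ∧ (app f x ==ᵐ just y))

  isPB⇒PartialBij : isPB α ≡ true → PartialBij α
  isPB⇒PartialBij e = record
    { defined = defined ; undefined = undefined ; injective = injective ; surjective = surjective }
    where
    total : ∀ x → totalOn x ≡ true
    total = forallP-elim totalOn (∧-elimˡ e)
    inj : ∀ x → forallP (injectiveAt x) ≡ true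
    inj = forallP-elim _ (∧-elimˡ (∧-elimʳ {forallP totalOn} e))
    surj : ∀ y → surjectiveAt y ≡ true
    surj = forallP-elim surjectiveAt (∧-elimʳ {forallP (λ x → forallP (injectiveAt x))} (∧-elimʳ {forallP totalOn} e))
    defined : ∀ x → inP d x ≡ true → ∃ λ y → app f x ≡ just y × inP d' y ≡ true
    defined x x∈d with total x
    ... | h rewrite x∈d with app f x
    ... | just y = y , refl , h
    undefined : ∀ x → inP d x ≡ false → app f x ≡ nothing
    undefined x x∉d with total x
    ... | h rewrite x∉d = ==ᵐ⇒≡ _ _ h
    injective : ∀ x x' → inP d x ≡ true → inP d x' ≡ true → app f x ≡ app f x' → x ≡ x'
    injective x x' x∈d x'∈d fx≡fx' with forallP-elim (injectiveAt x) (inj x) x'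
    ... | h rewrite x∈d | x'∈d | ≡⇒==ᵐ fx≡fx' = ==ᵖ⇒≡ x x' h
    surjective : ∀ y → inP d' y ≡ true → ∃ λ x → inP d x ≡ true × app f x ≡ just y
    surjective y y∈d' with surj y
    ... | h rewrite y∈d' =
      let (x , hx) = existsP-elim (λ x → inP d x ∧ (app f x ==ᵐ just y)) h
      in x , ∧-elimˡ hx , ==ᵐ⇒≡ _ _ (∧-elimʳ {inP d x} hx)

  PartialBij⇒isPB : PartialBij α → isPB α ≡ true
  PartialBij⇒isPB pb = ∧-intro (forallP-intro totalOn total)
    (∧-intro (forallP-intro _ (λ x → forallP-intro _ (inj x))) (forallP-intro surjectiveAt surj))
    where
    open PartialBij pb
    total : ∀ x → totalOn x ≡ true
    total x with inP d x in x∈d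
    ... | true with defined x x∈d
    ... | y , fx≡y , y∈d' rewrite fx≡y = y∈d'
    total x | false rewrite undefined x x∈d = refl
    inj : ∀ x x' → injectiveAt x x' ≡ true
    inj x x' with inP d x in x∈d | inP d x' in x'∈d | app f x ==ᵐ app f x' in eq
    ... | true | true | true rewrite injective x x' x∈d x'∈d (==ᵐ⇒≡ _ _ eq) = ∨-introʳ {false} (==ᵖ-refl x')
    ... | true | true | false = refl
    ... | true | false | _ = refl
    ... | false | _ | _ = refl
    surj : ∀ y → surjectiveAt y ≡ true
    surj y with inP d' y in y∈d'
    ... | false = refl
    ... | true = let (x , x∈d , fx≡y) = surjective y y∈d' in
      existsP-intro (λ x → inP d x ∧ (app f x ==ᵐ just y)) x (∧-intro x∈d (≡⇒==ᵐ fx≡y))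

toPartialBij : ∀ {n} {α : Triple n} → IsPartialBijection α → PartialBij α
toPartialBij {α = triple f d d'} t = isPB⇒PartialBij f d d' (Equivalence.to T-≡ t)

fromPartialBij : ∀ {n} {α : Triple n} → PartialBij α → IsPartialBijection α
fromPartialBij {α = triple f d d'} pb = Equivalence.from T-≡ (PartialBij⇒isPB f d d' pb)

module _ {n} {α : Triple n} (pb : PartialBij α) where
  open PartialBij pb
  private
    dom : List (Pt n)
    dom = filterᵇ (inP (d α)) (allPts n)
    image : List (Pt n)   -- the default of fromMaybe is never used, as σ is defined on d
    image = L.map (λ x → fromMaybe x (app (σ α) x)) dom
    ∈dom⇒∈d : ∀ {x} → x ∈ dom → inP (d α) x ≡ true
    ∈dom⇒∈d = ∈-filterᵇ⁻ (inP (d α)) (allPts n)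
    fromMaybe-σ : ∀ {x y} → app (σ α) x ≡ just y → fromMaybe x (app (σ α) x) ≡ y
    fromMaybe-σ σx≡y rewrite σx≡y = refl
    length-image : length image ≡ card (d α)
    length-image = begin
      length image                    ≡⟨ length-map _ dom ⟩
      length dom                      ≡⟨ length-filterᵇ (inP (d α)) (allPts n) ⟩
      count (inP (d α)) (allPts n)    ≡⟨ countP≡count (inP (d α)) ⟨
      countP (inP (d α))              ≡⟨ countP-inP (d α) ⟩
      card (d α)                      ∎
      where open ≡-Reasoning
    image-unique : Unique image
    image-unique = map-unique-on _ dom (filterᵇ-unique (inP (d α)) (allPts-unique n)) injOn
      where
      injOn : ∀ {x x'} → x ∈ dom → x' ∈ dom → fromMaybe x (app (σ α) x) ≡ fromMaybe x' (app (σ α) x') → x ≡ x'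
      injOn {x} {x'} m m' eq with defined x (∈dom⇒∈d m) | defined x' (∈dom⇒∈d m')
      ... | y , σx≡y , _ | y' , σx'≡y' , _ =
        injective x x' (∈dom⇒∈d m) (∈dom⇒∈d m')
          (trans σx≡y (trans (cong just (trans (sym (fromMaybe-σ σx≡y)) (trans eq (fromMaybe-σ σx'≡y')))) (sym σx'≡y')))
    image⊆d' : All (λ y → inP (d' α) y ≡ true) image
    image⊆d' = All.tabulate λ m → let (x , m , y≡) = ∈-map⁻ _ m ; (y , σx≡y , y∈d') = defined x (∈dom⇒∈d m) in
      subst (λ z → inP (d' α) z ≡ true) (sym (trans y≡ (fromMaybe-σ σx≡y))) y∈d'
    d'⊆image : ∀ {y} → inP (d' α) y ≡ true → y ∈ image
    d'⊆image {y} y∈d' = let (x , x∈d , σx≡y) = surjective y y∈d' in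
      subst (_∈ image) (fromMaybe-σ σx≡y) (∈-map⁺ _ (∈-filterᵇ⁺ (inP (d α)) (allPts-complete x) x∈d))

  ∣dom∣≡∣cod∣ : ∣ d α ∣ ≡ ∣ d' α ∣
  ∣dom∣≡∣cod∣ = *-cancelˡ-≡ ∣ d α ∣ ∣ d' α ∣ 2 (≤-antisym
    (subst (_≤ card (d' α)) length-image
      (subst (length image ≤_) (countP-inP (d' α)) (≤-countP (inP (d' α)) image image-unique image⊆d')))
    (subst (card (d' α) ≤_) length-image
      (subst (_≤ length image) (countP-inP (d' α)) (countP-≤ (inP (d' α)) image d'⊆image))))

module _ {n} (g : PMap n) (e e' : Pn n) where
  private
    γ : Triple n
    γ = triple g e e'

  adj-elim : ∀ z y → adj γ z y ≡ true → inP e z ≡ true × inP e y ≡ true ×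
    (y ≡ mate z ⊎ ∃ λ w → app g z ≡ just w × app g y ≡ just (mate w))
  adj-elim z y h with inP e z in z∈e | inP e y in y∈e
  ... | true | true with y ==ᵖ mate z in y≡mz
  ...   | true = refl , refl , inj₁ (==ᵖ⇒≡ y (mate z) y≡mz)
  ...   | false with app g z
  ...     | just w = refl , refl , inj₂ (w , refl , ==ᵐ⇒≡ _ _ h)
  adj-elim z y () | true | false
  adj-elim z y () | false | _

  adj-exterior : ∀ z → inP e z ≡ true → adj γ z (mate z) ≡ true
  adj-exterior z z∈e rewrite z∈e = ∨-introˡ (==ᵖ-refl (mate z))

  adj-interior : ∀ z y w → inP e z ≡ true → inP e y ≡ true → app g z ≡ just w → app g y ≡ just (mate w) →
    adj γ z y ≡ true
  adj-interior z y w z∈e y∈e gz gy rewrite z∈e | y∈e | gz | gy = ∨-introʳ {y ==ᵖ mate z} (==ᵖ-refl (mate w))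

module _ {n} (γ : Triple n) where
  reach-refl : ∀ k x → reach γ k x x ≡ true
  reach-refl zero x = ==ᵖ-refl x
  reach-refl (suc k) x = ∨-introˡ (reach-refl k x)

  reach-step : ∀ k x z y → reach γ k x z ≡ true → adj γ z y ≡ true → reach γ (suc k) x y ≡ true
  reach-step k x z y r a =
    ∨-introʳ {reach γ k x y} (existsP-intro (λ z → reach γ k x z ∧ adj γ z y) z (∧-intro r a))

  reach-closed : (Inv : Pt n → Set) → (∀ z y → Inv z → adj γ z y ≡ true → Inv y) →
    ∀ k x y → Inv x → reach γ k x y ≡ true → Inv y
  reach-closed Inv closed zero x y inv r = subst Inv (==ᵖ⇒≡ x y r) inv
  reach-closed Inv closed (suc k) x y inv r with ∨-elim {reach γ k x y} r
  ... | inj₁ r' = reach-closed Inv closed k x y inv r'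
  ... | inj₂ r' = let (z , hz) = existsP-elim (λ z → reach γ k x z ∧ adj γ z y) r' in
    closed z y (reach-closed Inv closed k x z inv (∧-elimˡ hz)) (∧-elimʳ {reach γ k x z} hz)

adj⇒reach : ∀ {n} (γ : Triple n) x y → adj γ x y ≡ true → reach γ (2 * n) x y ≡ true
adj⇒reach {zero} γ (() , _)
adj⇒reach {suc n} γ x y a = go (n + 1 * suc n)   -- 2 * suc n reduces to suc (n + 1 * suc n)
  where
  go : ∀ k → reach γ (suc k) x y ≡ true
  go zero = reach-step γ 0 x x y (reach-refl γ 0 x) a
  go (suc k) = ∨-introˡ (go k)

map-mate-involutive : ∀ {n} (a : Maybe (Pt n)) → M.map mate (M.map mate a) ≡ a
map-mate-involutive (just x) = cong just (mate-involutive x)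
map-mate-involutive nothing = refl

lookup-─ : ∀ {n} (e d : Subset n) k → lookup (e ─ d) k ≡ lookup e k ∧ not (lookup d k)
lookup-─ (a ∷ e) (true ∷ d) zero = sym (∧-zeroʳ a)
lookup-─ (a ∷ e) (false ∷ d) zero = sym (∧-identityʳ a)
lookup-─ (a ∷ e) (c ∷ d) (suc k) = lookup-─ e d k

[m+2n]/2≡m/2+n : ∀ m k → (m + 2 * k) / 2 ≡ m / 2 + k
[m+2n]/2≡m/2+n m k = trans (+-distrib-/-∣ʳ m (divides k (*-comm 2 k)))
  (cong (m / 2 +_) (trans (cong (_/ 2) (*-comm 2 k)) (m*n/n≡m k 2)))

PreservesBlock : ∀ {n} → PMap n → Pt n → Set
PreservesBlock g x = app g (mate x) ≡ M.map mate (app g x)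

preservesBlock? : ∀ {n} → PMap n → Pt n → Bool
preservesBlock? g x = app g (mate x) ==ᵐ M.map mate (app g x)

PreservesBlock-mate : ∀ {n} (g : PMap n) x → PreservesBlock g x → PreservesBlock g (mate x)
PreservesBlock-mate g x h = begin
  app g (mate (mate x))               ≡⟨ cong (app g) (mate-involutive x) ⟩
  app g x                             ≡⟨ map-mate-involutive (app g x) ⟨
  M.map mate (M.map mate (app g x))   ≡⟨ cong (M.map mate) h ⟨
  M.map mate (app g (mate x))         ∎
  where open ≡-Reasoning

preservesBlock?-mate : ∀ {n} (g : PMap n) x → preservesBlock? g (mate x) ≡ preservesBlock? g x
preservesBlock?-mate g x = ≡true-ext
  (λ h → ≡⇒==ᵐ (subst (PreservesBlock g) (mate-involutive x) (PreservesBlock-mate g (mate x) (==ᵐ⇒≡ _ _ h))))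
  (λ h → ≡⇒==ᵐ (PreservesBlock-mate g x (==ᵐ⇒≡ _ _ h)))

onCycles : ∀ {n} → Triple n → ℕ → ℕ
onCycles γ s = countP (λ x → inP (d γ) x ∧ (compSize γ x ≡ᵇ s))

module Extension {n} {f g : PMap n} {d d' e e' : Pn n}
  (pbα : PartialBij (triple f d d')) (pbβ : PartialBij (triple g e e'))
  (d⊆e : ∀ x → inP d x ≡ true → inP e x ≡ true)
  (g≡f : ∀ x → inP d x ≡ true → app g x ≡ app f x) where

  private
    α β : Triple n
    α = triple f d d'
    β = triple g e e'
    module α = PartialBij pbα
    module β = PartialBij pbβ

  adj-extension : ∀ z → inP d z ≡ true → ∀ y → adj β z y ≡ adj α z y
  adj-extension z z∈d y = ≡true-ext to from
    where
    to : adj β z y ≡ true → adj α z y ≡ true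
    to h with adj-elim g e e' z y h
    ... | _ , _ , inj₁ refl = adj-exterior f d d' z z∈d
    ... | _ , y∈e , inj₂ (w , gz , gy) =
      let (w' , fz , w'∈d') = α.defined z z∈d
          w≡w' = just-injective (trans (sym gz) (trans (g≡f z z∈d) fz))
          mw∈d' = trans (inP-mate d' w) (subst (λ u → inP d' u ≡ true) (sym w≡w') w'∈d')
          (x , x∈d , fx) = α.surjective (mate w) mw∈d'
          y≡x = β.injective y x y∈e (d⊆e x x∈d) (trans gy (trans (sym fx) (sym (g≡f x x∈d))))
          y∈d = subst (λ u → inP d u ≡ true) (sym y≡x) x∈d
      in adj-interior f d d' z y w z∈d y∈d (trans (sym (g≡f z z∈d)) gz) (trans (sym (g≡f y y∈d)) gy)
    from : adj α z y ≡ true → adj β z y ≡ true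
    from h with adj-elim f d d' z y h
    ... | _ , _ , inj₁ refl = adj-exterior g e e' z (d⊆e z z∈d)
    ... | _ , y∈d , inj₂ (w , fz , fy) =
      adj-interior g e e' z y w (d⊆e z z∈d) (d⊆e y y∈d) (trans (g≡f z z∈d) fz) (trans (g≡f y y∈d) fy)

  reach-extension : ∀ k x → inP d x ≡ true → ∀ y → reach β k x y ≡ reach α k x y
  reach-extension zero x x∈d y = refl
  reach-extension (suc k) x x∈d y =
    cong₂ _∨_ (reach-extension k x x∈d y) (existsP-cong _ _ step)
    where
    step : ∀ z → (reach β k x z ∧ adj β z y) ≡ (reach α k x z ∧ adj α z y)
    step z rewrite reach-extension k x x∈d z with reach α k x z in r
    ... | true = adj-extension z (reach-closed α (λ u → inP d u ≡ true)
                   (λ u v _ a → proj₁ (proj₂ (adj-elim f d d' u v a))) k x z x∈d r) y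
    ... | false = refl

  compSize-extension : ∀ x → inP d x ≡ true → compSize β x ≡ compSize α x
  compSize-extension x x∈d = countP-cong _ _ (reach-extension (2 * n) x x∈d)

  cod-extension : ∀ y → inP d' y ≡ true → inP e' y ≡ true
  cod-extension y y∈d' =
    let (x , x∈d , fx) = α.surjective y y∈d'
        (y' , gx , y'∈e') = β.defined x (d⊆e x x∈d)
    in subst (λ z → inP e' z ≡ true) (just-injective (trans (sym gx) (trans (g≡f x x∈d) fx))) y'∈e'

  old-image-∈cod : ∀ x y → inP d x ≡ true → app g x ≡ just y → inP d' y ≡ true
  old-image-∈cod x y x∈d gx =
    let (y' , fx , y'∈d') = α.defined x x∈d
    in subst (λ z → inP d' z ≡ true) (just-injective (trans (sym fx) (trans (sym (g≡f x x∈d)) gx))) y'∈d'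

  new-image-∉cod : ∀ x y → inP e x ≡ true → inP d x ≡ false → app g x ≡ just y → inP d' y ≡ false
  new-image-∉cod x y x∈e x∉d gx = ¬-not λ y∈d' →
    let (x' , x'∈d , fx') = α.surjective y y∈d'
        x≡x' = β.injective x x' x∈e (d⊆e x' x'∈d) (trans gx (trans (sym fx') (sym (g≡f x' x'∈d))))
    in true≢false (trans (sym x'∈d) (trans (cong (inP d) (sym x≡x')) x∉d))

  compSize-preserving : ∀ x → inP e x ≡ true → PreservesBlock g x → compSize β x ≡ 2
  compSize-preserving x x∈e pres = ≤-antisym
    (countP-≤ (reach β (2 * n) x) (x ∷ mate x ∷ [])
      (λ r → toList (reach-closed β Pair step (2 * n) x _ (inj₁ refl) r)))
    (≤-countP (reach β (2 * n) x) (x ∷ mate x ∷ []) ((mate-≢ x ∘ sym ∷ []) ∷ [] ∷ [])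
      (reach-refl β (2 * n) x ∷ adj⇒reach β x (mate x) (adj-exterior g e e' x x∈e) ∷ []))
    where
    Pair : Pt n → Set
    Pair u = u ≡ x ⊎ u ≡ mate x
    toList : ∀ {u} → Pair u → u ∈ x ∷ mate x ∷ []
    toList (inj₁ refl) = here refl
    toList (inj₂ refl) = there (here refl)
    mate-Pair : ∀ {u} → Pair u → Pair (mate u)
    mate-Pair (inj₁ refl) = inj₂ refl
    mate-Pair (inj₂ refl) = inj₁ (mate-involutive x)
    pres-Pair : ∀ {u} → Pair u → PreservesBlock g u
    pres-Pair (inj₁ refl) = pres
    pres-Pair (inj₂ refl) = PreservesBlock-mate g x pres
    step : ∀ z y → Pair z → adj β z y ≡ true → Pair y
    step z y pz a with adj-elim g e e' z y a
    ... | _ , _ , inj₁ refl = mate-Pair pz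
    ... | z∈e , y∈e , inj₂ (w , gz , gy) =
      let g-mz = trans (pres-Pair pz) (cong (M.map mate) gz)
          y≡mz = β.injective y (mate z) y∈e (trans (inP-mate e z) z∈e) (trans gy (sym g-mz))
      in subst Pair (sym y≡mz) (mate-Pair pz)

  3≤compSize : ∀ x → inP e x ≡ true → ¬ PreservesBlock g x → 3 ≤ compSize β x
  3≤compSize x x∈e nonpres with β.defined x x∈e
  ... | w , gx , w∈e' with β.surjective (mate w) (trans (inP-mate e' w) w∈e')
  ... | v , v∈e , gv = ≤-countP (reach β (2 * n) x) (x ∷ mate x ∷ v ∷ [])
      ((mate-≢ x ∘ sym ∷ x≢v ∷ []) ∷ (mx≢v ∷ []) ∷ [] ∷ [])
      (reach-refl β (2 * n) x ∷ adj⇒reach β x (mate x) (adj-exterior g e e' x x∈e)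
        ∷ adj⇒reach β x v (adj-interior g e e' x v w x∈e v∈e gx gv) ∷ [])
    where
    x≢v : x ≢ v
    x≢v refl = mate-≢ w (just-injective (trans (sym gv) gx))
    mx≢v : mate x ≢ v
    mx≢v refl = nonpres (trans gv (cong (M.map mate) (sym gx)))

  compSize≡ᵇ2 : ∀ x → inP e x ≡ true → (compSize β x ≡ᵇ 2) ≡ preservesBlock? g x
  compSize≡ᵇ2 x x∈e with preservesBlock? g x in pres?
  ... | true rewrite compSize-preserving x x∈e (==ᵐ⇒≡ _ _ pres?) = refl
  ... | false = ¬-not λ h →
    contradiction (subst (3 ≤_) (≡ᵇ⇒≡ _ 2 (Equivalence.from T-≡ h))
                    (3≤compSize x x∈e (λ pres → true≢false (trans (sym (≡⇒==ᵐ pres)) pres?))))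
                  λ { (s≤s (s≤s ())) }

  new : Pt n → Bool
  new x = inP e x ∧ not (inP d x)

  countP-new : countP new ≡ card (e ─ d)
  countP-new = trans (countP-cong new _ (λ { (k , _) → sym (lookup-─ e d k) })) (countP-inP (e ─ d))

  newOnCycles : ℕ → ℕ
  newOnCycles s = count (λ x → new x ∧ (compSize β x ≡ᵇ s)) (allPts n)

  onCycles-extension : ∀ s → onCycles β s ≡ onCycles α s + newOnCycles s
  onCycles-extension s =
    trans (countP≡count onβ) (trans (count-split onβ (inP d) (allPts n))
      (cong₂ _+_ (trans (count-cong _ _ (allPts n) old) (sym (countP≡count (λ x → inP d x ∧ (compSize α x ≡ᵇ s)))))
                 (count-cong _ _ (allPts n) fresh)))
    where
    onβ : Pt n → Bool
    onβ x = inP e x ∧ (compSize β x ≡ᵇ s)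
    old : ∀ x → (onβ x ∧ inP d x) ≡ (inP d x ∧ (compSize α x ≡ᵇ s))
    old x with inP d x in x∈d
    ... | true rewrite d⊆e x x∈d | compSize-extension x x∈d = ∧-identityʳ _
    ... | false = ∧-zeroʳ _
    fresh : ∀ x → (onβ x ∧ not (inP d x)) ≡ (new x ∧ (compSize β x ≡ᵇ s))
    fresh x with inP d x | inP e x
    ... | true | true = ∧-zeroʳ _
    ... | true | false = refl
    ... | false | true = ∧-identityʳ _
    ... | false | false = refl

  newOnCycles₂ : newOnCycles 2 ≡ count (λ x → new x ∧ preservesBlock? g x) (allPts n)
  newOnCycles₂ = count-cong _ _ (allPts n) pointwise
    where
    pointwise : ∀ x → (new x ∧ (compSize β x ≡ᵇ 2)) ≡ (new x ∧ preservesBlock? g x)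
    pointwise x with inP e x in x∈e | inP d x
    ... | true | false = compSize≡ᵇ2 x x∈e
    ... | true | true = refl
    ... | false | _ = refl

  newOnCycles-preserving : (∀ x → new x ≡ true → PreservesBlock g x) →
    ∀ s → newOnCycles s ≡ count (λ x → new x ∧ (2 ≡ᵇ s)) (allPts n)
  newOnCycles-preserving pres s = count-cong _ _ (allPts n) pointwise
    where
    pointwise : ∀ x → (new x ∧ (compSize β x ≡ᵇ s)) ≡ (new x ∧ (2 ≡ᵇ s))
    pointwise x with new x in x-new
    ... | true rewrite compSize-preserving x (∧-elimˡ x-new) (pres x x-new) = refl
    ... | false = refl

  ct₁-trivial⇒preserving : ct β 1 ≡ ct α 1 + ∣ e ─ d ∣ → ∀ x → new x ≡ true → PreservesBlock g x
  ct₁-trivial⇒preserving ct₁ x x-new =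
    ==ᵐ⇒≡ _ _ (count-∧-≡⇒ new (preservesBlock? g) (allPts n) new∧pres≡new (allPts-complete x) x-new)
    where
    open ≡-Reasoning
    o newBlocks : ℕ
    o = onCycles α 2
    newBlocks = count (λ k → new (k , zero) ∧ preservesBlock? g (k , zero)) (allFin n)
    new∧pres≡2blocks : count (λ x → new x ∧ preservesBlock? g x) (allPts n) ≡ 2 * newBlocks
    new∧pres≡2blocks = count-blocks _ (λ k → cong (new (k , zero) ∧_) (sym (preservesBlock?-mate g (k , zero))))
    ctβ : ct β 1 ≡ o / 2 + newBlocks
    ctβ = begin
      ct β 1                       ≡⟨ cong (_/ 2) (onCycles-extension 2) ⟩
      (o + newOnCycles 2) / 2      ≡⟨ cong (λ c → (o + c) / 2) (trans newOnCycles₂ new∧pres≡2blocks) ⟩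
      (o + 2 * newBlocks) / 2      ≡⟨ [m+2n]/2≡m/2+n o newBlocks ⟩
      o / 2 + newBlocks            ∎
    new∧pres≡new : count (λ x → new x ∧ preservesBlock? g x) (allPts n) ≡ count new (allPts n)
    new∧pres≡new = begin
      count (λ x → new x ∧ preservesBlock? g x) (allPts n)  ≡⟨ new∧pres≡2blocks ⟩
      2 * newBlocks                                          ≡⟨ cong (2 *_) (+-cancelˡ-≡ (o / 2) _ _ (trans (sym ctβ) ct₁)) ⟩
      card (e ─ d)                                           ≡⟨ countP-new ⟨
      countP new                                             ≡⟨ countP≡count new ⟩
      count new (allPts n)                                   ∎

  preserving⇒ct-trivial : (∀ x → new x ≡ true → PreservesBlock g x) →
    ∀ m → ct β (suc m) ≡ ct α (suc m) + ones ∣ e ─ d ∣ (suc m)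
  preserving⇒ct-trivial pres m = trans (cong (_/ (2 * suc m)) (onCycles-extension (2 * suc m))) (split m)
    where
    split : ∀ m → (onCycles α (2 * suc m) + newOnCycles (2 * suc m)) / (2 * suc m) ≡ ct α (suc m) + ones ∣ e ─ d ∣ (suc m)
    split zero = trans (cong (λ c → (onCycles α 2 + c) / 2)
        (trans (newOnCycles-preserving pres 2) (trans (count-cong _ new (allPts n) (λ x → ∧-identityʳ (new x)))
          (trans (sym (countP≡count new)) countP-new))))
      ([m+2n]/2≡m/2+n (onCycles α 2) _)
    split (suc m) = trans (cong (λ c → (onCycles α s + c) / s)
        (trans (newOnCycles-preserving pres s)
          (count-false _ (allPts n) (λ x → trans (cong (new x ∧_) 2≢s) (∧-zeroʳ (new x))))))
      (trans (cong (_/ s) (+-identityʳ (onCycles α s))) (sym (+-identityʳ (ct α (suc (suc m))))))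
      where
      s : ℕ
      s = 2 * suc (suc m)
      2≢s : (2 ≡ᵇ s) ≡ false
      2≢s = ¬-not λ h → <⇒≢ (*-monoʳ-< 2 (s≤s (s≤s z≤n))) (≡ᵇ⇒≡ 2 s (Equivalence.from T-≡ h))

record BlockExtension {n} (α β : Triple n) : Set where
  field
    partialBijective : PartialBij β
    domain⊆          : ∀ x → inP (d α) x ≡ true → inP (d β) x ≡ true
    restricts        : ∀ x → inP (d α) x ≡ true → app (σ β) x ≡ app (σ α) x
    preservesNew     : ∀ x → inP (d β) x ≡ true → inP (d α) x ≡ false → PreservesBlock (σ β) x

⊆⇒inP-⊆ : ∀ {n} {d e : Pn n} → d ⊆ e → ∀ x → inP d x ≡ true → inP e x ≡ true
⊆⇒inP-⊆ {d = d} d⊆e (k , b) k∈d = []=⇒lookup (d⊆e (lookup⇒[]= k d k∈d))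

inP-⊆⇒⊆ : ∀ {n} {d e : Pn n} → (∀ x → inP d x ≡ true → inP e x ≡ true) → d ⊆ e
inP-⊆⇒⊆ {e = e} d⊆e {k} k∈d = lookup⇒[]= k e (d⊆e (k , zero) ([]=⇒lookup k∈d))

card/2≡∣∣ : ∀ {n} (S : Pn n) → card S / 2 ≡ ∣ S ∣
card/2≡∣∣ S = trans (cong (_/ 2) (*-comm 2 ∣ S ∣)) (m*n/n≡m ∣ S ∣ 2)

trivial⇒blockExtension : ∀ {n} {α β : Triple n} → PartialBij α → IsTrivialExtension β α → BlockExtension α β
trivial⇒blockExtension {α = triple f d d'} {triple g e e'} pbα te = record
  { partialBijective = pbβ
  ; domain⊆ = d⊆e
  ; restricts = g≡f
  ; preservesNew = λ x x∈e x∉d → ct₁-trivial⇒preserving ct₁ x (cong₂ _∧_ x∈e (cong not x∉d)) }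
  where
  open IsTrivialExtension te
  pbβ : PartialBij (triple g e e')
  pbβ = toPartialBij partialBij
  d⊆e : ∀ x → inP d x ≡ true → inP e x ≡ true
  d⊆e = ⊆⇒inP-⊆ domSub
  g≡f : ∀ x → inP d x ≡ true → app g x ≡ app f x
  g≡f x x∈d = restrict x (Equivalence.from T-≡ x∈d)
  open Extension pbα pbβ d⊆e g≡f
  ct₁ : ct (triple g e e') 1 ≡ ct (triple f d d') 1 + ∣ e ─ d ∣
  ct₁ = trans (cosetType 0) (cong (ct (triple f d d') 1 +_) (card/2≡∣∣ (e ─ d)))

blockExtension⇒trivial : ∀ {n} {α β : Triple n} → PartialBij α → BlockExtension α β → IsTrivialExtension β α
blockExtension⇒trivial {α = α@(triple f d d')} {β@(triple g e e')} pbα be = record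
  { partialBij = fromPartialBij partialBijective
  ; domSub = inP-⊆⇒⊆ domain⊆
  ; restrict = λ x x∈d → restricts x (Equivalence.to T-≡ x∈d)
  ; cosetType = λ m → subst (λ j → ct β (suc m) ≡ ct α (suc m) + ones j (suc m))
      (sym (card/2≡∣∣ (e ─ d))) (preserving⇒ct-trivial pres m) }
  where
  open BlockExtension be
  open Extension pbα partialBijective domain⊆ restricts
  pres : ∀ x → new x ≡ true → PreservesBlock g x
  pres x x-new with inP d x in x∈d
  ... | false = preservesNew x (∧-elimˡ x-new) x∈d
  ... | true = contradiction (trans (sym x-new) (∧-zeroʳ (inP e x))) true≢false

length-concatMap : ∀ {A B : Set} (h : A → List B) xs K → (∀ {x} → x ∈ xs → length (h x) ≡ K) →
  length (L.concatMap h xs) ≡ length xs * K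
length-concatMap h [] K _ = refl
length-concatMap h (x ∷ xs) K lengths = trans (length-++ (h x))
  (cong₂ _+_ (lengths (here refl)) (length-concatMap h xs K (lengths ∘ there)))

concatMap-unique : ∀ {A B : Set} (h : A → List B) {xs} → Unique xs → (∀ x → Unique (h x)) →
  (∀ {x y} → x ≢ y → Disjoint (h x) (h y)) → Unique (L.concatMap h xs)
concatMap-unique h xs-unique h-unique h-disjoint =
  Unique.concat⁺ (AllP.map⁺ (All.universal h-unique _)) (AllPairsP.map⁺ (AllPairs.map h-disjoint xs-unique))

pred∸ : ∀ N j → pred N ∸ j ≡ N ∸ suc j
pred∸ zero j = 0∸n≡0 j
pred∸ (suc N) j = refl

P′-suc : ∀ N j → N P′ suc j ≡ N * (pred N P′ j)
P′-suc N zero = refl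
P′-suc N (suc j) = begin
  (N ∸ suc j) * (N P′ suc j)           ≡⟨ cong ((N ∸ suc j) *_) (P′-suc N j) ⟩
  (N ∸ suc j) * (N * (pred N P′ j))    ≡⟨ x*[y*z]≡y*[x*z] (N ∸ suc j) N _ ⟩
  N * ((N ∸ suc j) * (pred N P′ j))    ≡⟨ cong (λ k → N * (k * (pred N P′ j))) (pred∸ N j) ⟨
  N * ((pred N ∸ j) * (pred N P′ j))   ∎
  where
  open ≡-Reasoning
  x*[y*z]≡y*[x*z] : ∀ x y z → x * (y * z) ≡ y * (x * z)
  x*[y*z]≡y*[x*z] x y z = trans (sym (*-assoc x y z)) (trans (cong (_* z) (*-comm x y)) (*-assoc y x z))

P≡P′ : ∀ N j → N P j ≡ N P′ j
P≡P′ N j with j ≤ᵇ N in j≤ᵇN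
... | true = refl
... | false = sym (P′-vanishes j (≰⇒> (λ j≤N → subst T j≤ᵇN (≤⇒≤ᵇ j≤N))))
  where
  P′-vanishes : ∀ j → N < j → N P′ j ≡ 0
  P′-vanishes (suc j) (s≤s N≤j) rewrite m≤n⇒m∸n≡0 N≤j = refl

P-suc : ∀ N j → N P suc j ≡ N * (pred N P j)
P-suc N j = trans (P≡P′ N (suc j)) (trans (P′-suc N j) (cong (N *_) (sym (P≡P′ (pred N) j))))

∁-lookup : ∀ {k} (u : Subset k) t → lookup (∁ u) t ≡ true → lookup u t ≡ false
∁-lookup u t h = trans (sym (not-involutive _)) (cong not (trans (sym (lookup-map t not u)) h))

lookup-∁ : ∀ {k} (u : Subset k) t → lookup u t ≡ false → lookup (∁ u) t ≡ true
lookup-∁ u t h = trans (lookup-map t not u) (cong not h)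

∣∁∣-update : ∀ {k} (u : Subset k) t → lookup u t ≡ false → ∣ ∁ u ∣ ≡ suc ∣ ∁ (u [ t ]≔ true) ∣
∣∁∣-update (b ∷ u) zero refl = refl
∣∁∣-update (true ∷ u) (suc t) h = ∣∁∣-update u t h
∣∁∣-update (false ∷ u) (suc t) h = cong suc (∣∁∣-update u t h)

lookup-ext : ∀ {A : Set} {m} (v w : Vec A m) → (∀ i → lookup v i ≡ lookup w i) → v ≡ w
lookup-ext v w h = trans (sym (tabulate∘lookup v)) (trans (tabulate-cong h) (tabulate∘lookup w))

module _ {k} (u : Subset k) (t : Fin k) where
  lookup-insert-here : lookup (u [ t ]≔ true) t ≡ true
  lookup-insert-here = lookup∘update t u true

  lookup-insert-other : ∀ {t'} → t ≢ t' → lookup (u [ t ]≔ true) t' ≡ lookup u t'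
  lookup-insert-other t≢t' = lookup∘update′ (t≢t' ∘ sym) u true

  lookup-insert-mono : ∀ t' → lookup u t' ≡ true → lookup (u [ t ]≔ true) t' ≡ true
  lookup-insert-mono t' h with t F.≟ t'
  ... | yes refl = lookup-insert-here
  ... | no t≢t' = trans (lookup-insert-other t≢t') h

  lookup-insert⁻ : ∀ t' → lookup (u [ t ]≔ true) t' ≡ true → lookup u t' ≡ true ⊎ t ≡ t'
  lookup-insert⁻ t' h with t F.≟ t'
  ... | yes t≡t' = inj₂ t≡t'
  ... | no t≢t' = inj₁ (trans (sym (lookup-insert-other t≢t')) h)

module Enumeration {n : ℕ} where

  Row : Set
  Row = Vec (Maybe (Pt n)) 2

  emptyRow : Row
  emptyRow = nothing ∷ nothing ∷ []

  blockRow : Fin n → Fin 2 → Row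
  blockRow t o = just (t , o) ∷ just (t , flip2 o) ∷ []

  freeTargets : Subset n → List (Pt n)
  freeTargets u = filterᵇ (inP (∁ u)) (allPts n)

  extend : ∀ {m} → Row → List (Vec Row m × Subset n) → List (Vec Row (suc m) × Subset n)
  extend r = L.map (map₁ (r ∷_))

  -- The extensions of the rows rs, given on ds, to the domain xs that send the new blocks of
  -- xs ∖ ds onto distinct blocks outside u, each paired with the final set of used target blocks.
  fillings : ∀ {m} → Vec Row m → Subset m → Subset m → Subset n → List (Vec Row m × Subset n)
  fillingsTo : ∀ {m} → Vec Row m → Subset m → Subset m → Subset n → Pt n → List (Vec Row (suc m) × Subset n)

  fillings [] [] [] u = ([] , u) ∷ []
  fillings (r ∷ rs) (true ∷ ds) (x ∷ xs) u = extend r (fillings rs ds xs u)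
  fillings (r ∷ rs) (false ∷ ds) (false ∷ xs) u = extend emptyRow (fillings rs ds xs u)
  fillings (r ∷ rs) (false ∷ ds) (true ∷ xs) u = L.concatMap (fillingsTo rs ds xs u) (freeTargets u)

  fillingsTo rs ds xs u (t , o) = extend (blockRow t o) (fillings rs ds xs (u [ t ]≔ true))

  length-freeTargets : ∀ u → length (freeTargets u) ≡ 2 * ∣ ∁ u ∣
  length-freeTargets u =
    trans (length-filterᵇ (inP (∁ u)) (allPts n)) (trans (sym (countP≡count (inP (∁ u)))) (countP-inP (∁ u)))

  length-fillings : ∀ {m} (rs : Vec Row m) ds xs u →
    length (fillings rs ds xs u) ≡ 2 ^ ∣ xs ─ ds ∣ * (∣ ∁ u ∣ P ∣ xs ─ ds ∣)
  length-fillings [] [] [] u = refl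
  length-fillings (r ∷ rs) (true ∷ ds) (x ∷ xs) u = trans (length-map _ (fillings rs ds xs u)) (length-fillings rs ds xs u)
  length-fillings (r ∷ rs) (false ∷ ds) (false ∷ xs) u = trans (length-map _ (fillings rs ds xs u)) (length-fillings rs ds xs u)
  length-fillings (r ∷ rs) (false ∷ ds) (true ∷ xs) u = begin
    length (L.concatMap (fillingsTo rs ds xs u) (freeTargets u))  ≡⟨ length-concatMap _ (freeTargets u) _ length-each ⟩
    length (freeTargets u) * (2 ^ j * (pred F P j))              ≡⟨ cong (_* (2 ^ j * (pred F P j))) (length-freeTargets u) ⟩
    2 * F * (2 ^ j * (pred F P j))                               ≡⟨ rearrange F (2 ^ j) (pred F P j) ⟩
    2 * 2 ^ j * (F * (pred F P j))                               ≡⟨ cong (2 * 2 ^ j *_) (P-suc F j) ⟨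
    2 * 2 ^ j * (F P suc j)                                      ∎
    where
    open ≡-Reasoning
    j F : ℕ
    j = ∣ xs ─ ds ∣
    F = ∣ ∁ u ∣
    rearrange : ∀ a b c → 2 * a * (b * c) ≡ 2 * b * (a * c)
    rearrange = solve-∀
    length-each : ∀ {c} → c ∈ freeTargets u → length (fillingsTo rs ds xs u c) ≡ 2 ^ j * (pred F P j)
    length-each {t , o} c-free = begin
      length (extend (blockRow t o) (fillings rs ds xs (u [ t ]≔ true)))  ≡⟨ length-map _ (fillings rs ds xs _) ⟩
      length (fillings rs ds xs (u [ t ]≔ true))                          ≡⟨ length-fillings rs ds xs _ ⟩
      2 ^ j * (∣ ∁ (u [ t ]≔ true) ∣ P j)                                  ≡⟨ cong (λ k → 2 ^ j * (pred k P j)) (∣∁∣-update u t t-free) ⟨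
      2 ^ j * (pred F P j)                                                ∎
      where
      t-free : lookup u t ≡ false
      t-free = ∁-lookup u t (∈-filterᵇ⁻ (inP (∁ u)) (allPts n) c-free)

  extend-injective : ∀ {m} r {a b : Vec Row m × Subset n} → map₁ (r ∷_) a ≡ map₁ (r ∷_) b → a ≡ b
  extend-injective r {_ , u} {_ , v} eq = cong₂ _,_ (∷-injectiveʳ (cong proj₁ eq)) (cong proj₂ eq)

  blockRow-injective : ∀ {t o t' o'} → blockRow t o ≡ blockRow t' o' → (t , o) ≡ (t' , o')
  blockRow-injective eq = just-injective (cong (λ r → lookup r zero) eq)

  head-∈-fillingsTo : ∀ {m} (rs : Vec Row m) ds xs u c {v} → v ∈ fillingsTo rs ds xs u c →
    V.head (proj₁ v) ≡ blockRow (proj₁ c) (proj₂ c)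
  head-∈-fillingsTo rs ds xs u (t , o) m with ∈-map⁻ _ m
  ... | _ , _ , refl = refl

  fillings-unique : ∀ {m} (rs : Vec Row m) ds xs u → Unique (fillings rs ds xs u)
  fillings-unique [] [] [] u = [] ∷ []
  fillings-unique (r ∷ rs) (true ∷ ds) (x ∷ xs) u = Unique.map⁺ (extend-injective r) (fillings-unique rs ds xs u)
  fillings-unique (r ∷ rs) (false ∷ ds) (false ∷ xs) u = Unique.map⁺ (extend-injective emptyRow) (fillings-unique rs ds xs u)
  fillings-unique (r ∷ rs) (false ∷ ds) (true ∷ xs) u =
    concatMap-unique (fillingsTo rs ds xs u) (filterᵇ-unique _ (allPts-unique n))
      (λ { (t , o) → Unique.map⁺ (extend-injective _) (fillings-unique rs ds xs _) })
      (λ c≢c' (m , m') → c≢c' (blockRow-injective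
        (trans (sym (head-∈-fillingsTo rs ds xs u _ m)) (head-∈-fillingsTo rs ds xs u _ m'))))

  record Filling {m} (rs : Vec Row m) (ds xs : Subset m) (u : Subset n) (rs' : Vec Row m) (u' : Subset n) : Set where
    field
      keepsOld : ∀ i → lookup ds i ≡ true → lookup rs' i ≡ lookup rs i
      emptyOutside : ∀ i → lookup ds i ≡ false → lookup xs i ≡ false → lookup rs' i ≡ emptyRow
      newBlockRow : ∀ i → lookup ds i ≡ false → lookup xs i ≡ true → Σ (Pt n) λ (t , o) →
        lookup rs' i ≡ blockRow t o × lookup u t ≡ false × lookup u' t ≡ true
      newTargetsDistinct : ∀ i i' t o o' → lookup ds i ≡ false → lookup xs i ≡ true →
        lookup ds i' ≡ false → lookup xs i' ≡ true → lookup rs' i ≡ blockRow t o → lookup rs' i' ≡ blockRow t o' → i ≡ i'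
      used⊆ : ∀ t → lookup u t ≡ true → lookup u' t ≡ true
      ⊆used : ∀ t → lookup u' t ≡ true → lookup u t ≡ true ⊎
        ∃ λ i → lookup ds i ≡ false × lookup xs i ≡ true × ∃ λ o → lookup rs' i ≡ blockRow t o

  blockRow-target : ∀ {t o t' o'} → blockRow t o ≡ blockRow t' o' → t ≡ t'
  blockRow-target = cong proj₁ ∘ blockRow-injective

  Filling-tail : ∀ {m} {r : Row} {rs : Vec Row m} {b x ds xs u r' rs' u'} →
    Filling (r ∷ rs) (b ∷ ds) (x ∷ xs) u (r' ∷ rs') u' → (b ≡ false → x ≡ true → ⊥) → Filling rs ds xs u rs' u'
  Filling-tail {r = r} {b = b} {x} {ds} {xs} {u} {r'} {rs'} fill not-new = record
    { keepsOld = keepsOld ∘ suc ; emptyOutside = emptyOutside ∘ suc ; newBlockRow = newBlockRow ∘ suc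
    ; newTargetsDistinct = λ i i' t o o' a b c d e f →
        FP.suc-injective (newTargetsDistinct (suc i) (suc i') t o o' a b c d e f)
    ; used⊆ = used⊆
    ; ⊆used = λ t h → tail⊆used (⊆used t h) }
    where
    open Filling fill
    tail⊆used : ∀ {t} → lookup u t ≡ true ⊎
      ∃ (λ i → lookup (b ∷ ds) i ≡ false × lookup (x ∷ xs) i ≡ true × ∃ λ o → lookup (r' ∷ rs') i ≡ blockRow t o) →
      lookup u t ≡ true ⊎ ∃ λ i → lookup ds i ≡ false × lookup xs i ≡ true × ∃ λ o → lookup rs' i ≡ blockRow t o
    tail⊆used (inj₁ h) = inj₁ h
    tail⊆used (inj₂ (zero , a , b , _)) = ⊥-elim (not-new a b)
    tail⊆used (inj₂ (suc i , a , b , c)) = inj₂ (i , a , b , c)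

  Filling-tailNew : ∀ {m} {r : Row} {rs : Vec Row m} {ds xs u rs' u' t o} →
    Filling (r ∷ rs) (false ∷ ds) (true ∷ xs) u (blockRow t o ∷ rs') u' → lookup u t ≡ false →
    Filling rs ds xs (u [ t ]≔ true) rs' u'
  Filling-tailNew {ds = ds} {xs} {u} {rs'} {u'} {t} {o} fill t-free = record
    { keepsOld = keepsOld ∘ suc ; emptyOutside = emptyOutside ∘ suc
    ; newBlockRow = newBlockRow'
    ; newTargetsDistinct = λ i i' t o o' a b c d e f →
        FP.suc-injective (newTargetsDistinct (suc i) (suc i') t o o' a b c d e f)
    ; used⊆ = used⊆'
    ; ⊆used = ⊆used' }
    where
    open Filling fill
    t-used : lookup u' t ≡ true
    t-used with newBlockRow zero refl refl
    ... | _ , row≡ , _ , used with blockRow-target row≡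
    ... | refl = used
    newBlockRow' : ∀ i → lookup ds i ≡ false → lookup xs i ≡ true → Σ (Pt n) λ (t₁ , o₁) →
      lookup rs' i ≡ blockRow t₁ o₁ × lookup (u [ t ]≔ true) t₁ ≡ false × lookup u' t₁ ≡ true
    newBlockRow' i a b with newBlockRow (suc i) a b
    ... | (t₁ , o₁) , row≡ , free , used with t F.≟ t₁
    ...   | yes refl = ⊥-elim (FP.0≢1+n (newTargetsDistinct zero (suc i) t o o₁ refl refl a b refl row≡))
    ...   | no t≢t₁ = (t₁ , o₁) , row≡ , trans (lookup-insert-other u t t≢t₁) free , used
    used⊆' : ∀ t' → lookup (u [ t ]≔ true) t' ≡ true → lookup u' t' ≡ true
    used⊆' t' h with lookup-insert⁻ u t t' h
    ... | inj₁ h' = used⊆ t' h'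
    ... | inj₂ refl = t-used
    ⊆used' : ∀ t' → lookup u' t' ≡ true → lookup (u [ t ]≔ true) t' ≡ true ⊎
      ∃ λ i → lookup ds i ≡ false × lookup xs i ≡ true × ∃ λ o → lookup rs' i ≡ blockRow t' o
    ⊆used' t' h with ⊆used t' h
    ... | inj₁ h' = inj₁ (lookup-insert-mono u t t' h')
    ... | inj₂ (zero , _ , _ , _ , row≡) with blockRow-target row≡
    ...   | refl = inj₁ (lookup-insert-here u t)
    ⊆used' t' h | inj₂ (suc i , a , b , c) = inj₂ (i , a , b , c)

  Filling-consNew : ∀ {m} {r : Row} {rs : Vec Row m} {ds xs u rs' u' t o} →
    Filling rs ds xs (u [ t ]≔ true) rs' u' → lookup u t ≡ false →
    Filling (r ∷ rs) (false ∷ ds) (true ∷ xs) u (blockRow t o ∷ rs') u'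
  Filling-consNew {ds = ds} {xs} {u} {rs'} {u'} {t} {o} fill t-free = record
    { keepsOld = λ { zero () ; (suc i) → keepsOld i }
    ; emptyOutside = λ { zero _ () ; (suc i) → emptyOutside i }
    ; newBlockRow = λ { zero _ _ → (t , o) , refl , t-free , used⊆ t (lookup-insert-here u t)
                      ; (suc i) a b → let (c , row≡ , free , used) = newBlockRow i a b in
                          c , row≡ , free-before (proj₁ c) free , used }
    ; newTargetsDistinct = distinct
    ; used⊆ = λ t' h → used⊆ t' (lookup-insert-mono u t t' h)
    ; ⊆used = ⊆used' }
    where
    open Filling fill
    free-before : ∀ t' → lookup (u [ t ]≔ true) t' ≡ false → lookup u t' ≡ false
    free-before t' h = ¬-not λ h' → true≢false (trans (sym (lookup-insert-mono u t t' h')) h)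
    new-target-≢-t : ∀ i t' o' → lookup ds i ≡ false → lookup xs i ≡ true → lookup rs' i ≡ blockRow t' o' → t ≢ t'
    new-target-≢-t i t' o' a b row≡ refl with newBlockRow i a b
    ... | (t₁ , o₁) , row≡₁ , free , _ with blockRow-target (trans (sym row≡) row≡₁)
    ... | refl = true≢false (trans (sym (lookup-insert-here u t)) free)
    distinct : ∀ i i' t' o₁ o₂ → lookup (false ∷ ds) i ≡ false → lookup (true ∷ xs) i ≡ true →
      lookup (false ∷ ds) i' ≡ false → lookup (true ∷ xs) i' ≡ true →
      lookup (blockRow t o ∷ rs') i ≡ blockRow t' o₁ → lookup (blockRow t o ∷ rs') i' ≡ blockRow t' o₂ → i ≡ i'
    distinct zero zero _ _ _ _ _ _ _ _ _ = refl
    distinct zero (suc i') t' o₁ o₂ _ _ c d e f = ⊥-elim (new-target-≢-t i' t' o₂ c d f (blockRow-target e))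
    distinct (suc i) zero t' o₁ o₂ a b _ _ e f = ⊥-elim (new-target-≢-t i t' o₁ a b e (blockRow-target f))
    distinct (suc i) (suc i') t' o₁ o₂ a b c d e f = cong suc (newTargetsDistinct i i' t' o₁ o₂ a b c d e f)
    ⊆used' : ∀ t' → lookup u' t' ≡ true → lookup u t' ≡ true ⊎
      ∃ λ i → lookup (false ∷ ds) i ≡ false × lookup (true ∷ xs) i ≡ true × ∃ λ o' → lookup (blockRow t o ∷ rs') i ≡ blockRow t' o'
    ⊆used' t' h with ⊆used t' h
    ... | inj₂ (i , rest) = inj₂ (suc i , rest)
    ... | inj₁ h' with lookup-insert⁻ u t t' h'
    ...   | inj₁ h'' = inj₁ h''
    ...   | inj₂ refl = inj₂ (zero , refl , refl , o , refl)

  fillings-sound : ∀ {m} (rs : Vec Row m) ds xs u {rs' u'} → (rs' , u') ∈ fillings rs ds xs u →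
    Filling rs ds xs u rs' u'
  fillings-sound [] [] [] u {[]} (here refl) = record
    { keepsOld = λ () ; emptyOutside = λ () ; newBlockRow = λ () ; newTargetsDistinct = λ ()
    ; used⊆ = λ _ h → h ; ⊆used = λ _ h → inj₁ h }
  fillings-sound (r ∷ rs) (true ∷ ds) (x ∷ xs) u m with ∈-map⁻ (map₁ (r ∷_)) m
  ... | _ , m' , refl = record
    { keepsOld = λ { zero _ → refl ; (suc i) h → keepsOld i h }
    ; emptyOutside = λ { zero () ; (suc i) → emptyOutside i }
    ; newBlockRow = λ { zero () ; (suc i) → newBlockRow i }
    ; newTargetsDistinct = λ { zero _ _ _ _ () ; (suc i) zero _ _ _ _ _ () ;
        (suc i) (suc i') t o o' a b c d e f → cong suc (newTargetsDistinct i i' t o o' a b c d e f) }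
    ; used⊆ = used⊆
    ; ⊆used = λ t h → Sum.map₂ (λ (i , rest) → suc i , rest) (⊆used t h) }
    where open Filling (fillings-sound rs ds xs u m')
  fillings-sound (r ∷ rs) (false ∷ ds) (false ∷ xs) u m with ∈-map⁻ (map₁ (emptyRow ∷_)) m
  ... | _ , m' , refl = record
    { keepsOld = λ { zero () ; (suc i) → keepsOld i }
    ; emptyOutside = λ { zero _ _ → refl ; (suc i) → emptyOutside i }
    ; newBlockRow = λ { zero _ () ; (suc i) → newBlockRow i }
    ; newTargetsDistinct = λ { zero _ _ _ _ _ () ; (suc i) zero _ _ _ _ _ _ () ;
        (suc i) (suc i') t o o' a b c d e f → cong suc (newTargetsDistinct i i' t o o' a b c d e f) }
    ; used⊆ = used⊆
    ; ⊆used = λ t h → Sum.map₂ (λ (i , rest) → suc i , rest) (⊆used t h) }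
    where open Filling (fillings-sound rs ds xs u m')
  fillings-sound (r ∷ rs) (false ∷ ds) (true ∷ xs) u m
    with find (∈-concatMap⁻ (fillingsTo rs ds xs u) {xs = freeTargets u} m)
  ... | (t , o) , t-free , m₁ with ∈-map⁻ (map₁ (blockRow t o ∷_)) m₁
  ... | _ , m' , refl = Filling-consNew (fillings-sound rs ds xs (u [ t ]≔ true) m')
                          (∁-lookup u t (∈-filterᵇ⁻ (inP (∁ u)) (allPts n) t-free))

  fillings-complete : ∀ {m} (rs : Vec Row m) ds xs u rs' u' → Filling rs ds xs u rs' u' →
    (rs' , u') ∈ fillings rs ds xs u
  fillings-complete [] [] [] u [] u' fill =
    here (cong ([] ,_) (lookup-ext u' u (λ t → ≡true-ext (λ h → [ id , (λ { (() , _) }) ]′ (⊆used t h)) (used⊆ t))))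
    where open Filling fill
  fillings-complete (r ∷ rs) (true ∷ ds) (x ∷ xs) u (r' ∷ rs') u' fill with Filling.keepsOld fill zero refl
  ... | refl = ∈-map⁺ (map₁ (r ∷_)) (fillings-complete rs ds xs u rs' u' (Filling-tail fill λ ()))
  fillings-complete (r ∷ rs) (false ∷ ds) (false ∷ xs) u (r' ∷ rs') u' fill with Filling.emptyOutside fill zero refl refl
  ... | refl = ∈-map⁺ (map₁ (emptyRow ∷_)) (fillings-complete rs ds xs u rs' u' (Filling-tail fill λ _ ()))
  fillings-complete (r ∷ rs) (false ∷ ds) (true ∷ xs) u (r' ∷ rs') u' fill with Filling.newBlockRow fill zero refl refl
  ... | (t , o) , refl , t-free , _ =
    ∈-concatMap⁺ (fillingsTo rs ds xs u)
      (lose (∈-filterᵇ⁺ (inP (∁ u)) (allPts-complete (t , o)) (lookup-∁ u t t-free))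
        (∈-map⁺ (map₁ (blockRow t o ∷_))
          (fillings-complete rs ds xs (u [ t ]≔ true) rs' u' (Filling-tailNew fill t-free))))

  blockRow-value : ∀ t o b → ∃ λ c → lookup (blockRow t o) b ≡ just (t , c)
  blockRow-value t o zero = o , refl
  blockRow-value t o (suc zero) = flip2 o , refl

  blockRow-hits : ∀ t o c → ∃ λ b → lookup (blockRow t o) b ≡ just (t , c)
  blockRow-hits t zero zero = zero , refl
  blockRow-hits t zero (suc zero) = suc zero , refl
  blockRow-hits t (suc zero) zero = suc zero , refl
  blockRow-hits t (suc zero) (suc zero) = zero , refl

  blockRow-injectiveAt : ∀ t o b b' → lookup (blockRow t o) b ≡ lookup (blockRow t o) b' → b ≡ b'
  blockRow-injectiveAt t o zero zero _ = refl
  blockRow-injectiveAt t o (suc zero) (suc zero) _ = refl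
  blockRow-injectiveAt t o zero (suc zero) eq = ⊥-elim (flip2-≢ o (sym (cong proj₂ (just-injective eq))))
  blockRow-injectiveAt t o (suc zero) zero eq = ⊥-elim (flip2-≢ o (cong proj₂ (just-injective eq)))

  blockRow-preserves : ∀ t o b → lookup (blockRow t o) (flip2 b) ≡ M.map mate (lookup (blockRow t o) b)
  blockRow-preserves t o zero = refl
  blockRow-preserves t o (suc zero) = cong (λ c → just (t , c)) (sym (flip2-involutive o))

  lookup-emptyRow : ∀ b → lookup emptyRow b ≡ nothing
  lookup-emptyRow zero = refl
  lookup-emptyRow (suc zero) = refl

  ≡blockRow : ∀ (r : Row) t o → lookup r zero ≡ just (t , o) → lookup r (suc zero) ≡ just (t , flip2 o) → r ≡ blockRow t o
  ≡blockRow (a ∷ b ∷ []) t o a≡ b≡ = cong₂ _∷_ a≡ (cong₂ _∷_ b≡ refl)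

  module _ {f : PMap n} {d d' : Pn n} (pbα : PartialBij (triple f d d')) {X : Pn n}
           (d⊆X : ∀ x → inP d x ≡ true → inP X x ≡ true) where
    private module α = PartialBij pbα

    blockExtension⇒Filling : ∀ {g e'} → BlockExtension (triple f d d') (triple g X e') → Filling f d X d' g e'
    blockExtension⇒Filling {g} {e'} be = record
      { keepsOld = λ i i∈d → lookup-ext _ _ (λ b → restricts (i , b) i∈d)
      ; emptyOutside = λ i _ i∉X → lookup-ext _ _ (λ b → trans (β.undefined (i , b) i∉X) (sym (lookup-emptyRow b)))
      ; newBlockRow = newBlockRow
      ; newTargetsDistinct = distinct
      ; used⊆ = λ t t∈d' → cod-extension (t , zero) t∈d'
      ; ⊆used = ⊆used }
      where
      open BlockExtension be
      module β = PartialBij partialBijective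
      open Extension pbα partialBijective domain⊆ restricts
      newBlockRow : ∀ i → lookup d i ≡ false → lookup X i ≡ true → Σ (Pt n) λ (t , o) →
        lookup g i ≡ blockRow t o × lookup d' t ≡ false × lookup e' t ≡ true
      newBlockRow i i∉d i∈X with β.defined (i , zero) i∈X
      ... | (t , o) , g-i0 , t∈e' =
        (t , o) , ≡blockRow (lookup g i) t o g-i0 (trans (preservesNew (i , zero) i∈X i∉d) (cong (M.map mate) g-i0))
                , new-image-∉cod (i , zero) (t , o) i∈X i∉d g-i0 , t∈e'
      distinct : ∀ i i' t o o' → lookup d i ≡ false → lookup X i ≡ true → lookup d i' ≡ false → lookup X i' ≡ true →
        lookup g i ≡ blockRow t o → lookup g i' ≡ blockRow t o' → i ≡ i'
      distinct i i' t o o' _ i∈X _ i'∈X row row' =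
        let (b' , hit) = blockRow-hits t o' o
        in cong proj₁ (β.injective (i , zero) (i' , b') i∈X i'∈X
             (trans (cong (λ r → lookup r zero) row) (sym (trans (cong (λ r → lookup r b') row') hit))))
      ⊆used : ∀ t → lookup e' t ≡ true → lookup d' t ≡ true ⊎
        ∃ λ i → lookup d i ≡ false × lookup X i ≡ true × ∃ λ o → lookup g i ≡ blockRow t o
      ⊆used t t∈e' with β.surjective (t , zero) t∈e'
      ... | (i , b) , i∈X , g-ib with lookup d i in i∈d
      ...   | true = inj₁ (old-image-∈cod (i , b) (t , zero) i∈d g-ib)
      ...   | false with newBlockRow i i∈d i∈X
      ...     | (t₁ , o₁) , row , _ with blockRow-value t₁ o₁ b
      ...       | c , hit with just-injective (trans (sym g-ib) (trans (cong (λ r → lookup r b) row) hit))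
      ...         | refl = inj₂ (i , i∈d , i∈X , o₁ , row)

    module _ {g : PMap n} {e' : Pn n} (fill : Filling f d X d' g e') where
      open Filling fill

      private
        X∌⇒d∌ : ∀ i → lookup X i ≡ false → lookup d i ≡ false
        X∌⇒d∌ i i∉X = ¬-not λ i∈d → true≢false (trans (sym (d⊆X (i , zero) i∈d)) i∉X)

        g-old : ∀ i b → lookup d i ≡ true → app g (i , b) ≡ app f (i , b)
        g-old i b i∈d = cong (λ r → lookup r b) (keepsOld i i∈d)

        g-new : ∀ i b → lookup d i ≡ false → lookup X i ≡ true → Σ (Pt n) λ (t , o) →
          lookup g i ≡ blockRow t o × lookup d' t ≡ false × lookup e' t ≡ true × ∃ λ c → app g (i , b) ≡ just (t , c)
        g-new i b i∉d i∈X with newBlockRow i i∉d i∈X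
        ... | (t , o) , row , t∉d' , t∈e' = let (c , hit) = blockRow-value t o b in
          (t , o) , row , t∉d' , t∈e' , c , trans (cong (λ r → lookup r b) row) hit

        old≢new : ∀ x x' → inP d x ≡ true → inP d x' ≡ false → inP X x' ≡ true → app g x ≢ app g x'
        old≢new (i , b) (i' , b') i∈d i'∉d i'∈X eq with α.defined (i , b) i∈d | g-new i' b' i'∉d i'∈X
        ... | y , fx , y∈d' | (t , _) , _ , t∉d' , _ , c , gx' =
          let y≡ = just-injective (trans (sym fx) (trans (sym (g-old i b i∈d)) (trans eq gx')))
          in true≢false (trans (sym y∈d') (trans (cong (inP d') y≡) t∉d'))

        defined : ∀ x → inP X x ≡ true → ∃ λ y → app g x ≡ just y × inP e' y ≡ true
        defined (i , b) i∈X with lookup d i in i∈d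
        ... | true = let (y , fx , y∈d') = α.defined (i , b) i∈d in
          y , trans (g-old i b i∈d) fx , used⊆ (proj₁ y) y∈d'
        ... | false = let ((t , _) , _ , _ , t∈e' , c , gx) = g-new i b i∈d i∈X in (t , c) , gx , t∈e'

        injective : ∀ x x' → inP X x ≡ true → inP X x' ≡ true → app g x ≡ app g x' → x ≡ x'
        injective (i , b) (i' , b') i∈X i'∈X eq with lookup d i in i∈d | lookup d i' in i'∈d
        ... | true | true = α.injective (i , b) (i' , b') i∈d i'∈d
              (trans (sym (g-old i b i∈d)) (trans eq (g-old i' b' i'∈d)))
        ... | true | false = ⊥-elim (old≢new (i , b) (i' , b') i∈d i'∈d i'∈X eq)
        ... | false | true = ⊥-elim (old≢new (i' , b') (i , b) i'∈d i∈d i∈X (sym eq))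
        ... | false | false with g-new i b i∈d i∈X | g-new i' b' i'∈d i'∈X
        ...   | (t , o) , row , _ , _ , _ , gx | (t' , o') , row' , _ , _ , _ , gx'
          with cong proj₁ (just-injective (trans (sym gx) (trans eq gx')))
        ...     | refl with newTargetsDistinct i i' t o o' i∈d i∈X i'∈d i'∈X row row'
        ...       | refl with blockRow-injective (trans (sym row) row')
        ...         | refl = cong (i ,_) (blockRow-injectiveAt t o b b'
                      (trans (sym (cong (λ r → lookup r b) row)) (trans eq (cong (λ r → lookup r b') row))))

        surjective : ∀ y → inP e' y ≡ true → ∃ λ x → inP X x ≡ true × app g x ≡ just y
        surjective (t , c) t∈e' with ⊆used t t∈e'
        ... | inj₁ t∈d' = let (x , x∈d , fx) = α.surjective (t , c) t∈d' in
          x , d⊆X x x∈d , trans (g-old (proj₁ x) (proj₂ x) x∈d) fx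
        ... | inj₂ (i , _ , i∈X , o , row) = let (b , hit) = blockRow-hits t o c in
          (i , b) , i∈X , trans (cong (λ r → lookup r b) row) hit

      Filling⇒blockExtension : BlockExtension (triple f d d') (triple g X e')
      Filling⇒blockExtension = record
        { partialBijective = record
          { defined = defined
          ; undefined = λ { (i , b) i∉X →
              trans (cong (λ r → lookup r b) (emptyOutside i (X∌⇒d∌ i i∉X) i∉X)) (lookup-emptyRow b) }
          ; injective = injective
          ; surjective = surjective }
        ; domain⊆ = d⊆X
        ; restricts = λ { (i , b) i∈d → g-old i b i∈d }
        ; preservesNew = λ { (i , b) i∈X i∉d → let (_ , row , _) = newBlockRow i i∉d i∈X in
            subst (λ r → lookup r (flip2 b) ≡ M.map mate (lookup r b)) (sym row) (blockRow-preserves _ _ b) } }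

trivialExtensions-withDomain : ∀ {n} {α : Triple n} → PartialBij α → (X : Pn n) → d α ⊆ X →
  HasCount (λ β → IsTrivialExtension β α × d β ≡ X) (2 ^ ∣ X ─ d α ∣ * ((n ∸ ∣ d' α ∣) P ∣ X ─ d α ∣))
trivialExtensions-withDomain {n} {α} pbα X d⊆X =
  L.map toTriple fills , Unique.map⁺ toTriple-injective (fillings-unique (σ α) (d α) X (d' α)) ,
  (λ β → mk⇔ (sound β) (complete β)) , len
  where
  open Enumeration {n}
  fills : List (Vec Row n × Subset n)
  fills = fillings (σ α) (d α) X (d' α)
  toTriple : Vec Row n × Subset n → Triple n
  toTriple (g , e') = triple g X e'
  toTriple-injective : ∀ {a b} → toTriple a ≡ toTriple b → a ≡ b
  toTriple-injective {_ , _} {_ , _} eq = cong₂ _,_ (cong σ eq) (cong d' eq)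
  sound : ∀ β → β ∈ L.map toTriple fills → IsTrivialExtension β α × d β ≡ X
  sound β m with ∈-map⁻ toTriple m
  ... | (g , e') , m' , refl =
    blockExtension⇒trivial pbα
      (Filling⇒blockExtension pbα (⊆⇒inP-⊆ d⊆X) (fillings-sound (σ α) (d α) X (d' α) m')) , refl
  complete : ∀ β → IsTrivialExtension β α × d β ≡ X → β ∈ L.map toTriple fills
  complete (triple g _ e') (te , refl) = ∈-map⁺ toTriple (fillings-complete (σ α) (d α) X (d' α) g e'
    (blockExtension⇒Filling pbα (⊆⇒inP-⊆ d⊆X) (trivial⇒blockExtension pbα te)))
  j : ℕ
  j = ∣ X ─ d α ∣
  len : length (L.map toTriple fills) ≡ 2 ^ j * ((n ∸ ∣ d' α ∣) P j)
  len = begin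
    length (L.map toTriple fills)       ≡⟨ length-map toTriple fills ⟩
    length fills                        ≡⟨ length-fillings (σ α) (d α) X (d' α) ⟩
    2 ^ j * (∣ ∁ (d' α) ∣ P j)           ≡⟨ cong (λ k → 2 ^ j * (k P j)) (∣∁p∣≡n∸∣p∣ (d' α)) ⟩
    2 ^ j * ((n ∸ ∣ d' α ∣) P j)         ∎
    where open ≡-Reasoning

findᵇ-sound : ∀ {A : Set} (p : A → Bool) xs {x} → L.findᵇ p xs ≡ just x → p x ≡ true
findᵇ-sound p (y ∷ xs) eq with p y in py
... | true = subst (λ z → p z ≡ true) (just-injective eq) py
... | false = findᵇ-sound p xs eq

findᵇ-unique : ∀ {A : Set} (p : A → Bool) xs {x} → x ∈ xs → p x ≡ true → (∀ z → p z ≡ true → z ≡ x) →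
  L.findᵇ p xs ≡ just x
findᵇ-unique p (y ∷ xs) (here refl) px _ rewrite px = refl
findᵇ-unique p (y ∷ xs) (there m) px unique with p y in py
... | true = cong just (unique y py)
... | false = findᵇ-unique p xs m px unique

preimage : ∀ {n} → PMap n → Pt n → Maybe (Pt n)
preimage {n} g y = L.findᵇ (λ x → app g x ==ᵐ just y) (allPts n)

invert : ∀ {n} → PMap n → PMap n
invert g = V.tabulate λ k → V.tabulate λ b → preimage g (k , b)

inverse : ∀ {n} → Triple n → Triple n
inverse (triple g e e') = triple (invert g) e' e

app-invert : ∀ {n} (g : PMap n) y → app (invert g) y ≡ preimage g y
app-invert g (k , b) = trans (cong (λ r → lookup r b) (lookup∘tabulate _ k)) (lookup∘tabulate (λ b → preimage g (k , b)) b)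

invert-sound : ∀ {n} (g : PMap n) {x y} → app (invert g) y ≡ just x → app g x ≡ just y
invert-sound {n} g {y = y} eq =
  ==ᵐ⇒≡ _ _ (findᵇ-sound (λ x → app g x ==ᵐ just y) (allPts n) (trans (sym (app-invert g y)) eq))

module _ {n} {g : PMap n} {e e' : Pn n} (pb : PartialBij (triple g e e')) where
  open PartialBij pb

  invert-complete : ∀ {x y} → app g x ≡ just y → app (invert g) y ≡ just x
  invert-complete {x} {y} gx = trans (app-invert g y)
    (findᵇ-unique _ (allPts n) (allPts-complete x) (≡⇒==ᵐ gx) λ z gz →
      let gz≡y = ==ᵐ⇒≡ _ _ gz in
      injective z x (defined⇒inDomain z gz≡y) (defined⇒inDomain x gx) (trans gz≡y (sym gx)))

  inverse-partialBij : PartialBij (triple (invert g) e' e)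
  inverse-partialBij = record
    { defined = λ y y∈e' → let (x , x∈e , gx) = surjective y y∈e' in x , invert-complete gx , x∈e
    ; undefined = undefined'
    ; injective = λ y y' y∈e' _ eq → let (x , x∈e , gx) = surjective y y∈e' ; hx = invert-complete gx in
        just-injective (trans (sym (invert-sound g hx)) (invert-sound g (trans (sym eq) hx)))
    ; surjective = λ x x∈e → let (y , gx , y∈e') = defined x x∈e in y , y∈e' , invert-complete gx }
    where
    undefined' : ∀ y → inP e' y ≡ false → app (invert g) y ≡ nothing
    undefined' y y∉e' with app (invert g) y in hy
    ... | nothing = refl
    ... | just x = let gx = invert-sound g hy ; (y' , gx' , y'∈e') = defined x (defined⇒inDomain x gx) in
      contradiction (trans (sym y'∈e') (trans (cong (inP e') (just-injective (trans (sym gx') gx))) y∉e')) true≢false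

invert-involutive : ∀ {n} {g : PMap n} {e e' : Pn n} → PartialBij (triple g e e') → invert (invert g) ≡ g
invert-involutive {g = g} pb = lookup-ext _ _ λ k → lookup-ext _ _ λ b → pointwise (k , b)
  where
  pointwise : ∀ x → app (invert (invert g)) x ≡ app g x
  pointwise x with app g x in gx
  ... | just y = invert-complete (inverse-partialBij pb) (invert-complete pb gx)
  ... | nothing with app (invert (invert g)) x in hx
  ...   | nothing = refl
  ...   | just y = contradiction (trans (sym gx) (invert-sound g (invert-sound (invert g) hx))) nothing≢just

inverse-involutive : ∀ {n} {β : Triple n} → PartialBij β → inverse (inverse β) ≡ β
inverse-involutive {β = triple g e e'} pb = cong (λ h → triple h e e') (invert-involutive pb)

blockExtension-inverse : ∀ {n} {α β : Triple n} → PartialBij α → BlockExtension α β →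
  BlockExtension (inverse α) (inverse β)
blockExtension-inverse {α = triple f d d'} {triple g e e'} pbα be = record
  { partialBijective = inverse-partialBij partialBijective
  ; domain⊆ = cod-extension
  ; restricts = λ y y∈d' → let (x , x∈d , fx) = α.surjective y y∈d' in
      trans (invert-complete partialBijective (trans (restricts x x∈d) fx)) (sym (invert-complete pbα fx))
  ; preservesNew = preservesNew' }
  where
  open BlockExtension be
  module α = PartialBij pbα
  module β = PartialBij partialBijective
  open Extension pbα partialBijective domain⊆ restricts
  preservesNew' : ∀ y → inP e' y ≡ true → inP d' y ≡ false → PreservesBlock (invert g) y
  preservesNew' y y∈e' y∉d' with β.surjective y y∈e'
  ... | x , x∈e , gx with inP d x in x∈d
  ...   | true = contradiction (trans (sym (old-image-∈cod x y x∈d gx)) y∉d') true≢false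
  ...   | false = trans (invert-complete partialBijective (trans (preservesNew x x∈e x∈d) (cong (M.map mate) gx)))
                    (cong (M.map mate) (sym (invert-complete partialBijective gx)))

trivialExtension-inverse : ∀ {n} {α β : Triple n} → PartialBij α → IsTrivialExtension β α →
  IsTrivialExtension (inverse β) (inverse α)
trivialExtension-inverse {α = triple _ _ _} pbα te =
  blockExtension⇒trivial (inverse-partialBij pbα) (blockExtension-inverse pbα (trivial⇒blockExtension pbα te))

trivialExtensions-withCodomain : ∀ {n} {α : Triple n} → PartialBij α → (X : Pn n) → d' α ⊆ X →
  HasCount (λ β → IsTrivialExtension β α × d' β ≡ X) (2 ^ ∣ X ─ d' α ∣ * ((n ∸ ∣ d α ∣) P ∣ X ─ d' α ∣))
trivialExtensions-withCodomain {α = α@(triple _ _ _)} pbα X d'⊆X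
  with trivialExtensions-withDomain (inverse-partialBij pbα) X d'⊆X
... | L , L-unique , L-spec , L-length =
  L.map inverse L , map-unique-on inverse L L-unique inverse-injectiveOn , (λ β → mk⇔ (sound β) (complete β)) ,
  trans (length-map inverse L) L-length
  where
  pb-∈L : ∀ {γ} → γ ∈ L → PartialBij γ
  pb-∈L m = toPartialBij (IsTrivialExtension.partialBij (proj₁ (Equivalence.to (L-spec _) m)))
  inverse-injectiveOn : ∀ {γ γ'} → γ ∈ L → γ' ∈ L → inverse γ ≡ inverse γ' → γ ≡ γ'
  inverse-injectiveOn m m' eq =
    trans (sym (inverse-involutive (pb-∈L m))) (trans (cong inverse eq) (inverse-involutive (pb-∈L m')))
  sound : ∀ β → β ∈ L.map inverse L → IsTrivialExtension β α × d' β ≡ X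
  sound β m with ∈-map⁻ inverse m
  ... | γ@(triple _ _ _) , m' , refl =
    let (te , dγ≡X) = Equivalence.to (L-spec γ) m' in
    subst (IsTrivialExtension (inverse γ)) (inverse-involutive pbα)
      (trivialExtension-inverse (inverse-partialBij pbα) te) , dγ≡X
  complete : ∀ β → IsTrivialExtension β α × d' β ≡ X → β ∈ L.map inverse L
  complete β@(triple _ _ _) (te , d'β≡X) =
    subst (_∈ L.map inverse L) (inverse-involutive (toPartialBij (IsTrivialExtension.partialBij te)))
    (∈-map⁺ inverse (Equivalence.from (L-spec (inverse β)) (trivialExtension-inverse pbα te , d'β≡X)))

lemma3p1 : (n : ℕ) → 1 ≤ n → (α : Triple n) → IsPartialBijection α →
    ((X : Pn n) → d α ⊆ X →
      HasCount (λ α̃ → IsTrivialExtension α̃ α × d α̃ ≡ X)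
        (2 ^ (card (X ─ d α) / 2) * ((n ∸ card (d α) / 2) P (card (X ─ d α) / 2))))
    × ((X : Pn n) → d' α ⊆ X →
      HasCount (λ α̃ → IsTrivialExtension α̃ α × d' α̃ ≡ X)
        (2 ^ (card (X ─ d' α) / 2) * ((n ∸ card (d α) / 2) P (card (X ─ d' α) / 2))))
lemma3p1 n _ α α-pb =
  (λ X d⊆X → subst (HasCount _) (formula (X ─ d α) (sym (∣dom∣≡∣cod∣ pb)))
               (trivialExtensions-withDomain pb X d⊆X)) ,
  (λ X d'⊆X → subst (HasCount _) (formula (X ─ d' α) refl)
               (trivialExtensions-withCodomain pb X d'⊆X))
  where
  pb : PartialBij α
  pb = toPartialBij α-pb
  formula : ∀ (S : Pn n) {k} → k ≡ ∣ d α ∣ →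
    2 ^ ∣ S ∣ * ((n ∸ k) P ∣ S ∣) ≡ 2 ^ (card S / 2) * ((n ∸ card (d α) / 2) P (card S / 2))
  formula S refl rewrite card/2≡∣∣ S | card/2≡∣∣ (d α) = refl
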